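{- Let $K_n$ be the complete graph on $[n]$ ($n\ge1$). Then $X_{K_n,n}=(n-1)!\,e_{n,n}$, where $e_{n,n}=\sum_{k=1}^n(-t)^{k-1}e_{n-k}$.
   Context: For a graph $G$, $S\subseteq E(G)$ and vertex $v$: $G_S$ is the graph with vertex set $V(G)$ and edge set $S$; $\mathrm{type}_v^-(G_S)$ is the partition of the sizes of the connected components of $G_S$ not containing $v$, and $\mathrm{type}_v^+(G_S)$ the size of the component containing $v$. The pointed chromatic symmetric function is $X_{G,v}=\sum_{S\subseteq E(G)}(-1)^{|S|}p_{\mathrm{type}_v^-(G_S)}t^{\mathrm{type}_v^+(G_S)-1}\in\Lambda[t]$, where $\Lambda$ is the ring of symmetric functions, $p_\lambda$ power sums and $e_k$ elementary symmetric functions ($e_0=1$). (In the paper, $e_{n,n}$ is defined as the pointed Schur function $s_{(1^n),1}$, which equals the displayed sum.) -}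

module Defs where

open import Data.Nat as ℕ using (ℕ; zero; suc; _∸_; _<ᵇ_; _≡ᵇ_)
open import Data.Integer as ℤ using (ℤ; +_; -_; _*_; _+_; _^_)
open import Data.Fin as Fin using (Fin; toℕ)
open import Data.List using (List; []; _∷_; [_]; _++_; map; foldr; length; allFin; filterᵇ; concatMap; upTo)
open import Data.Bool using (Bool; true; false; _∧_; _∨_; not; if_then_else_)
open import Data.Bool.ListAction using (any)
open import Data.Product using (_×_; _,_; proj₁; proj₂)
open import Relation.Nullary.Decidable using (⌊_⌋)

Graph : ℕ → Set
Graph n = List (Fin n × Fin n)

-- All sub-lists (= all subsets of the underlying set of positions).
subs : ∀ {A : Set} → List A → List (List A)
subs [] = [ [] ]
subs (a ∷ as) = subs as ++ map (a ∷_) (subs as)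

sumℤ : List ℤ → ℤ
sumℤ = foldr _+_ (+ 0)

prodℤ : List ℤ → ℤ
prodℤ = foldr _*_ (+ 1)

module _ {n : ℕ} where
  eqF : Fin n → Fin n → Bool
  eqF a b = ⌊ a Fin.≟ b ⌋

  adj : Graph n → Fin n → Fin n → Bool
  adj S a b = any (λ e → (eqF (proj₁ e) a ∧ eqF (proj₂ e) b) ∨ (eqF (proj₁ e) b ∧ eqF (proj₂ e) a)) S

  reachIn : ℕ → Graph n → Fin n → Fin n → Bool
  reachIn zero S i j = eqF i j
  reachIn (suc k) S i j = reachIn k S i j ∨ any (λ m → reachIn k S i m ∧ adj S m j) (allFin n)

  conn : Graph n → Fin n → Fin n → Bool
  conn S i j = reachIn n S i j

  compSize : Graph n → Fin n → ℕ
  compSize S i = length (filterᵇ (conn S i) (allFin n))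

  -- u is the least vertex of its component (one representative per component)
  isRep : Graph n → Fin n → Bool
  isRep S u = not (any (λ j → (toℕ j <ᵇ toℕ u) ∧ conn S u j) (allFin n))

-- Evaluation of symmetric functions at finitely many variables xs : List ℤ.
powerSum : List ℤ → ℕ → ℤ
powerSum xs k = sumℤ (map (λ x → x ^ k) xs)

elemSym : List ℤ → ℕ → ℤ
elemSym xs k = sumℤ (map prodℤ (filterᵇ (λ s → length s ≡ᵇ k) (subs xs)))

pTypeMinus : ∀ {n} → Graph n → Fin n → List ℤ → ℤ
pTypeMinus {n} S v xs =
  prodℤ (map (λ u → powerSum xs (compSize S u))
             (filterᵇ (λ u → isRep S u ∧ not (conn S v u)) (allFin n)))

X : ∀ {n} → Graph n → Fin n → List ℤ → ℤ → ℤ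
X G v xs t = sumℤ (map (λ S → (- + 1) ^ length S * pTypeMinus S v xs * t ^ (compSize S v ∸ 1)) (subs G))

-- complete graph K_n on Fin n (vertex k ↔ k+1 ∈ [n])
K : (n : ℕ) → Graph n
K n = concatMap (λ i → map (λ j → (i , j)) (filterᵇ (λ j → toℕ i <ᵇ toℕ j) (allFin n))) (allFin n)

enn : ℕ → List ℤ → ℤ → ℤ
enn n xs t = sumℤ (map (λ k → (- t) ^ (k ∸ 1) * elemSym xs (n ∸ k)) (map suc (upTo n)))

-- Write X_G(q) and X_{G,v}(q, w) for X_G and X_{G,v} with p_k specialised to q k and t ^ (k - 1) to
-- w k.  View K_{n+1} as the cone over K_n with apex v and sum first over the edges to the apex: for
-- a fixed edge set H of K_n, each component of H of size k either stays apart from v or is absorbed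
-- into the component of v, and the alternating sum over the nonempty edge sets joining it to v is
-- -1; so it contributes p_k - t ^ k, and X_{K_{n+1},v}(p, t ^ (k - 1)) = X_{K_n}(p_k - t ^ k).  For
-- a virtual alphabet P - M (p_k = Σ_P y ^ k - Σ_M z ^ k) one shows X_{K_n}[P - M] = n! e_n[P - M] by
-- induction: X_{K_{n+1}}(q) = X_{K_{n+1},v}(q, q) is linear in the second q, and writing
-- q k = Σ_P y · y ^ (k - 1) - Σ_M z · z ^ (k - 1) the cone identity turns it into
-- n! (Σ_P y e_n[P - M - y] - Σ_M z e_n[P - M - z]), which is (n+1)! e_{n+1}[P - M] by Newton's
-- identity E′ = E · (Σ_P y / (1 + y x) - Σ_M z / (1 + z x)) for E = ∏_P (1 + y x) / ∏_M (1 + z x).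
-- Finally e_{n,n} = e_{n-1}[xs - t].

module Submission where

open import Defs
open import Data.Nat as ℕ using (ℕ; zero; suc; _∸_; _!; _≤_; _<_; z≤n; s≤s; _<ᵇ_; _≡ᵇ_)
import Data.Nat.Properties as ℕP
open import Data.Integer as ℤ using (ℤ; +_; -_; _+_; _-_; _*_; _^_)
import Data.Integer.Properties as ℤP
open import Data.Integer.Tactic.RingSolver using (solve-∀)
open import Algebra.Properties.CommutativeSemigroup ℤP.*-commutativeSemigroup using (x∙yz≈y∙xz)
open import Algebra.Properties.CommutativeSemigroup ℤP.+-commutativeSemigroup using (interchange)
open import Data.Fin as Fin using (Fin; toℕ; fromℕ; inject₁)
import Data.Fin.Properties as FinP
open import Data.List using (List; []; _∷_; [_]; _++_; map; length; filterᵇ; allFin; tabulate; concat; upTo; applyUpTo)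
import Data.List.Properties as ListP
open import Data.List.Membership.Propositional using (_∈_)
open import Data.List.Membership.Propositional.Properties using (∈-allFin; ∈-map⁺)
open import Data.List.Relation.Unary.Any using (here; there)
open import Data.List.Relation.Binary.Permutation.Propositional as Perm using (_↭_; prep; swap; ↭-trans; ↭-sym; ↭-reflexive)
import Data.List.Relation.Binary.Permutation.Propositional.Properties as PermP
open import Data.Bool using (Bool; true; false; _∧_; _∨_; not; if_then_else_)
open import Data.Bool.ListAction using (any)
import Data.Bool.Properties as BoolP
open import Data.Product using (∃; _×_; _,_; proj₁; proj₂)
open import Data.Sum using (_⊎_; inj₁; inj₂; [_,_]′)
open import Data.Empty using (⊥-elim)
open import Function using (_∘_; mk⇔; Equivalence)
open import Relation.Nullary using (¬_; yes; no)
open import Relation.Binary using (tri<; tri≈; tri>)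
open import Relation.Nullary.Decidable using (T?)
open import Relation.Binary.Construct.Closure.ReflexiveTransitive as Star using (Star; ε; _◅_; _◅◅_)
open import Relation.Binary.PropositionalEquality
  using (_≡_; _≢_; _≗_; refl; sym; trans; cong; cong₂; subst; subst₂; module ≡-Reasoning)

∨-true⁻ : ∀ a {b} → a ∨ b ≡ true → a ≡ true ⊎ b ≡ true
∨-true⁻ true  _ = inj₁ refl
∨-true⁻ false e = inj₂ e

∨-trueˡ : ∀ {a} b → a ≡ true → a ∨ b ≡ true
∨-trueˡ b refl = refl

∨-trueʳ : ∀ a {b} → b ≡ true → a ∨ b ≡ true
∨-trueʳ true  _ = refl
∨-trueʳ false e = e

∧-true⁻ : ∀ a {b} → a ∧ b ≡ true → a ≡ true × b ≡ true
∧-true⁻ true e = refl , e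

∧-true⁺ : ∀ {a b} → a ≡ true → b ≡ true → a ∧ b ≡ true
∧-true⁺ refl refl = refl

not-true⁻ : ∀ {a} → not a ≡ true → a ≡ false
not-true⁻ {false} _ = refl

not-false⁻ : ∀ {a} → not a ≡ false → a ≡ true
not-false⁻ {true} _ = refl

true⇔true⇒≡ : ∀ {a b} → (a ≡ true → b ≡ true) → (b ≡ true → a ≡ true) → a ≡ b
true⇔true⇒≡ f g = BoolP.⇔→≡ (mk⇔ f g)

bool-cases : ∀ b → b ≡ true ⊎ b ≡ false
bool-cases true  = inj₁ refl
bool-cases false = inj₂ refl

module _ {A : Set} where

  any-true⁻ : ∀ (p : A → Bool) xs → any p xs ≡ true → ∃ λ x → p x ≡ true × x ∈ xs
  any-true⁻ p (x ∷ xs) e with ∨-true⁻ (p x) e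
  ... | inj₁ px = x , px , here refl
  ... | inj₂ r with any-true⁻ p xs r
  ...   | y , py , y∈xs = y , py , there y∈xs

  any-true⁺ : ∀ (p : A → Bool) {x xs} → x ∈ xs → p x ≡ true → any p xs ≡ true
  any-true⁺ p {xs = y ∷ _} (here refl) px = ∨-trueˡ _ px
  any-true⁺ p {xs = y ∷ _} (there x∈xs) px = ∨-trueʳ (p y) (any-true⁺ p x∈xs px)

  any-false⁺ : ∀ (p : A → Bool) xs → (∀ x → p x ≡ false) → any p xs ≡ false
  any-false⁺ p []       h = refl
  any-false⁺ p (x ∷ xs) h = cong₂ _∨_ (h x) (any-false⁺ p xs h)

  any-cong : ∀ {p q : A → Bool} → p ≗ q → ∀ xs → any p xs ≡ any q xs
  any-cong e []       = refl
  any-cong e (x ∷ xs) = cong₂ _∨_ (e x) (any-cong e xs)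

  any-++ : ∀ (p : A → Bool) xs ys → any p (xs ++ ys) ≡ any p xs ∨ any p ys
  any-++ p []       ys = refl
  any-++ p (x ∷ xs) ys = trans (cong (p x ∨_) (any-++ p xs ys)) (sym (BoolP.∨-assoc (p x) _ _))

  any-map : ∀ {B : Set} (p : B → Bool) (f : A → B) xs → any p (map f xs) ≡ any (p ∘ f) xs
  any-map p f []       = refl
  any-map p f (x ∷ xs) = cong (p (f x) ∨_) (any-map p f xs)

  any-↭ : ∀ (p : A → Bool) {xs ys} → xs ↭ ys → any p xs ≡ any p ys
  any-↭ p Perm.refl        = refl
  any-↭ p (prep x q)       = cong (p x ∨_) (any-↭ p q)
  any-↭ p (swap x y q)     = trans (cong (λ r → p x ∨ (p y ∨ r)) (any-↭ p q)) (∨-swap (p x) (p y) _)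
    where
      ∨-swap : ∀ a b c → a ∨ (b ∨ c) ≡ b ∨ (a ∨ c)
      ∨-swap true  b c = sym (BoolP.∨-zeroʳ b)
      ∨-swap false b c = refl
  any-↭ p (Perm.trans q r) = trans (any-↭ p q) (any-↭ p r)

  filterᵇ-accept : ∀ (p : A → Bool) {x} xs → p x ≡ true → filterᵇ p (x ∷ xs) ≡ x ∷ filterᵇ p xs
  filterᵇ-accept p xs e rewrite e = refl

  filterᵇ-reject : ∀ (p : A → Bool) {x} xs → p x ≡ false → filterᵇ p (x ∷ xs) ≡ filterᵇ p xs
  filterᵇ-reject p xs e rewrite e = refl

  filterᵇ-cong : ∀ {p q : A → Bool} → p ≗ q → ∀ xs → filterᵇ p xs ≡ filterᵇ q xs
  filterᵇ-cong e [] = refl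
  filterᵇ-cong {p} {q} e (x ∷ xs) with p x | q x | e x
  ... | true  | true  | refl = cong (x ∷_) (filterᵇ-cong e xs)
  ... | false | false | refl = filterᵇ-cong e xs

  filterᵇ-none : ∀ (p : A → Bool) xs → (∀ x → p x ≡ false) → filterᵇ p xs ≡ []
  filterᵇ-none p []       h = refl
  filterᵇ-none p (x ∷ xs) h = trans (filterᵇ-reject p xs (h x)) (filterᵇ-none p xs h)

  filterᵇ-++ : ∀ (p : A → Bool) xs ys → filterᵇ p (xs ++ ys) ≡ filterᵇ p xs ++ filterᵇ p ys
  filterᵇ-++ p = ListP.filter-++ (T? ∘ p)

  filterᵇ-map : ∀ {B : Set} (p : B → Bool) (f : A → B) xs → filterᵇ p (map f xs) ≡ map f (filterᵇ (p ∘ f) xs)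
  filterᵇ-map p f [] = refl
  filterᵇ-map p f (x ∷ xs) with p (f x)
  ... | true  = cong (f x ∷_) (filterᵇ-map p f xs)
  ... | false = filterᵇ-map p f xs

  count : (A → Bool) → List A → ℕ
  count p xs = length (filterᵇ p xs)

  count-mono : ∀ {p q : A → Bool} → (∀ x → p x ≡ true → q x ≡ true) → ∀ xs → count p xs ≤ count q xs
  count-mono h [] = z≤n
  count-mono {p} {q} h (x ∷ xs) with p x in px | q x in qx
  ... | true  | true  = s≤s (count-mono h xs)
  ... | true  | false = ⊥-elim (BoolP.not-¬ (h x px) qx)
  ... | false | true  = ℕP.m≤n⇒m≤1+n (count-mono h xs)
  ... | false | false = count-mono h xs

  count-strict : ∀ {p q : A → Bool} → (∀ x → p x ≡ true → q x ≡ true) →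
                 ∀ {y xs} → y ∈ xs → p y ≡ false → q y ≡ true → suc (count p xs) ≤ count q xs
  count-strict h {xs = x ∷ xs} (here refl) py qy rewrite py | qy = s≤s (count-mono h xs)
  count-strict {p} {q} h {xs = x ∷ xs} (there y∈xs) py qy with p x in px | q x in qx
  ... | true  | true  = s≤s (count-strict h y∈xs py qy)
  ... | true  | false = ⊥-elim (BoolP.not-¬ (h x px) qx)
  ... | false | true  = ℕP.m≤n⇒m≤1+n (count-strict h y∈xs py qy)
  ... | false | false = count-strict h y∈xs py qy

  count-∨ : ∀ (p q : A → Bool) → (∀ x → p x ≡ true → q x ≡ false) →
            ∀ xs → count (λ x → p x ∨ q x) xs ≡ count p xs ℕ.+ count q xs
  count-∨ p q h [] = refl
  count-∨ p q h (x ∷ xs) with p x in px | q x in qx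
  ... | true  | true  = ⊥-elim (BoolP.not-¬ qx (h x px))
  ... | true  | false = cong suc (count-∨ p q h xs)
  ... | false | true  = trans (cong suc (count-∨ p q h xs)) (sym (ℕP.+-suc _ _))
  ... | false | false = count-∨ p q h xs

m-n+n≡m : ∀ m n → m - n + n ≡ m
m-n+n≡m = solve-∀

m+n-n≡m : ∀ m n → m + n - n ≡ m
m+n-n≡m = solve-∀

sumℤ-++ : ∀ xs ys → sumℤ (xs ++ ys) ≡ sumℤ xs + sumℤ ys
sumℤ-++ []       ys = sym (ℤP.+-identityˡ _)
sumℤ-++ (x ∷ xs) ys = trans (cong (_+_ x) (sumℤ-++ xs ys)) (sym (ℤP.+-assoc x _ _))

module _ {A : Set} where

  sumℤ-map-*ˡ : ∀ c (f : A → ℤ) L → sumℤ (map (λ a → c * f a) L) ≡ c * sumℤ (map f L)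
  sumℤ-map-*ˡ c f []      = sym (ℤP.*-zeroʳ c)
  sumℤ-map-*ˡ c f (a ∷ L) = trans (cong (_+_ (c * f a)) (sumℤ-map-*ˡ c f L)) (sym (ℤP.*-distribˡ-+ c (f a) _))

  sumℤ-map-+ : ∀ (f g : A → ℤ) L → sumℤ (map (λ a → f a + g a) L) ≡ sumℤ (map f L) + sumℤ (map g L)
  sumℤ-map-+ f g []      = refl
  sumℤ-map-+ f g (a ∷ L) = trans (cong (_+_ (f a + g a)) (sumℤ-map-+ f g L)) (interchange (f a) (g a) _ _)

  neg-sumℤ-map : ∀ (f : A → ℤ) L → - sumℤ (map f L) ≡ sumℤ (map (λ a → - f a) L)
  neg-sumℤ-map f []      = refl
  neg-sumℤ-map f (a ∷ L) = trans (ℤP.neg-distrib-+ (f a) _) (cong (_+_ (- f a)) (neg-sumℤ-map f L))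

  prodℤ-filterᵇ-split : ∀ (p q : A → Bool) (f : A → ℤ) xs →
    prodℤ (map f (filterᵇ p xs)) ≡
    prodℤ (map f (filterᵇ (λ x → p x ∧ q x) xs)) * prodℤ (map f (filterᵇ (λ x → p x ∧ not (q x)) xs))
  prodℤ-filterᵇ-split p q f [] = refl
  prodℤ-filterᵇ-split p q f (x ∷ xs) with p x | q x
  ... | false | _     = prodℤ-filterᵇ-split p q f xs
  ... | true  | true  = trans (cong (f x *_) (prodℤ-filterᵇ-split p q f xs)) (sym (ℤP.*-assoc (f x) _ _))
  ... | true  | false = trans (cong (f x *_) (prodℤ-filterᵇ-split p q f xs))
                              (x∙yz≈y∙xz (f x) (prodℤ (map f (filterᵇ (λ x → p x ∧ q x) xs))) _)

  prodℤ-filterᵇ-cong : ∀ (p : A → Bool) {f g : A → ℤ} → (∀ x → p x ≡ true → f x ≡ g x) →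
    ∀ xs → prodℤ (map f (filterᵇ p xs)) ≡ prodℤ (map g (filterᵇ p xs))
  prodℤ-filterᵇ-cong p e [] = refl
  prodℤ-filterᵇ-cong p e (x ∷ xs) with p x in px
  ... | true  = cong₂ _*_ (e x px) (prodℤ-filterᵇ-cong p e xs)
  ... | false = prodℤ-filterᵇ-cong p e xs

sumℤ-map-comm : ∀ {A B : Set} (f : A → B → ℤ) L₁ L₂ →
  sumℤ (map (λ a → sumℤ (map (f a) L₂)) L₁) ≡ sumℤ (map (λ b → sumℤ (map (λ a → f a b) L₁)) L₂)
sumℤ-map-comm f [] L₂ = sym (sum-zeros L₂)
  where
    sum-zeros : ∀ {C : Set} (L : List C) → sumℤ (map (λ _ → + 0) L) ≡ + 0
    sum-zeros []      = refl
    sum-zeros (_ ∷ L) = trans (ℤP.+-identityˡ _) (sum-zeros L)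
sumℤ-map-comm f (a ∷ L₁) L₂ =
  trans (cong (_+_ (sumℤ (map (f a) L₂))) (sumℤ-map-comm f L₁ L₂)) (sym (sumℤ-map-+ (f a) _ L₂))

sumSubs : ∀ {A : Set} → (List A → ℤ) → List A → ℤ
sumSubs f L = sumℤ (map f (subs L))

RespectsPerm : ∀ {A : Set} → (List A → ℤ) → Set
RespectsPerm f = ∀ {S S′} → S ↭ S′ → f S ≡ f S′

sumSubs-∷ : ∀ {A : Set} (f : List A → ℤ) x L → sumSubs f (x ∷ L) ≡ sumSubs f L + sumSubs (f ∘ (x ∷_)) L
sumSubs-∷ f x L = begin
  sumℤ (map f (subs L ++ map (x ∷_) (subs L)))        ≡⟨ cong sumℤ (ListP.map-++ f (subs L) _) ⟩
  sumℤ (map f (subs L) ++ map f (map (x ∷_) (subs L))) ≡⟨ sumℤ-++ (map f (subs L)) _ ⟩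
  sumSubs f L + sumℤ (map f (map (x ∷_) (subs L)))     ≡⟨ cong (λ s → sumSubs f L + sumℤ s) (ListP.map-∘ (subs L)) ⟨
  sumSubs f L + sumSubs (f ∘ (x ∷_)) L                 ∎
  where open ≡-Reasoning

sumSubs-↭ : ∀ {A : Set} {xs ys : List A} → xs ↭ ys → ∀ f → RespectsPerm f → sumSubs f xs ≡ sumSubs f ys
sumSubs-↭ Perm.refl f resp = refl
sumSubs-↭ {xs = x ∷ xs} {x ∷ ys} (prep x p) f resp =
  trans (sumSubs-∷ f x xs)
    (trans (cong₂ _+_ (sumSubs-↭ p f resp) (sumSubs-↭ p (f ∘ (x ∷_)) (resp ∘ prep x)))
           (sym (sumSubs-∷ f x ys)))
sumSubs-↭ {xs = x ∷ y ∷ xs} {y ∷ x ∷ ys} (swap x y p) f resp = begin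
  sumSubs f (x ∷ y ∷ xs)
    ≡⟨ expand x y xs ⟩
  (sumSubs f xs + sumSubs (f ∘ (y ∷_)) xs) + (sumSubs (f ∘ (x ∷_)) xs + sumSubs (λ S → f (x ∷ y ∷ S)) xs)
    ≡⟨ interchange (sumSubs f xs) (sumSubs (f ∘ (y ∷_)) xs) (sumSubs (f ∘ (x ∷_)) xs) _ ⟩
  (sumSubs f xs + sumSubs (f ∘ (x ∷_)) xs) + (sumSubs (f ∘ (y ∷_)) xs + sumSubs (λ S → f (x ∷ y ∷ S)) xs)
    ≡⟨ cong₂ _+_ (cong₂ _+_ (sumSubs-↭ p f resp) (sumSubs-↭ p (f ∘ (x ∷_)) (resp ∘ prep x)))
                 (cong₂ _+_ (sumSubs-↭ p (f ∘ (y ∷_)) (resp ∘ prep y))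
                            (trans (cong sumℤ (ListP.map-cong (λ _ → resp (swap x y Perm.refl)) (subs xs)))
                                   (sumSubs-↭ p (λ S → f (y ∷ x ∷ S)) (resp ∘ prep y ∘ prep x)))) ⟩
  (sumSubs f ys + sumSubs (f ∘ (x ∷_)) ys) + (sumSubs (f ∘ (y ∷_)) ys + sumSubs (λ S → f (y ∷ x ∷ S)) ys)
    ≡⟨ expand y x ys ⟨
  sumSubs f (y ∷ x ∷ ys) ∎
  where
    open ≡-Reasoning
    expand : ∀ u w zs → sumSubs f (u ∷ w ∷ zs) ≡
      (sumSubs f zs + sumSubs (f ∘ (w ∷_)) zs) + (sumSubs (f ∘ (u ∷_)) zs + sumSubs (λ S → f (u ∷ w ∷ S)) zs)
    expand u w zs = trans (sumSubs-∷ f u (w ∷ zs)) (cong₂ _+_ (sumSubs-∷ f w zs) (sumSubs-∷ (f ∘ (u ∷_)) w zs))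
sumSubs-↭ (Perm.trans p q) f resp = trans (sumSubs-↭ p f resp) (sumSubs-↭ q f resp)

sumSubs-++ : ∀ {A : Set} (f : List A → ℤ) L₁ L₂ →
  sumSubs f (L₁ ++ L₂) ≡ sumSubs (λ S → sumSubs (λ T → f (S ++ T)) L₂) L₁
sumSubs-++ f []       L₂ = sym (ℤP.+-identityʳ _)
sumSubs-++ f (x ∷ L₁) L₂ =
  trans (sumSubs-∷ f x (L₁ ++ L₂))
    (trans (cong₂ _+_ (sumSubs-++ f L₁ L₂) (sumSubs-++ (f ∘ (x ∷_)) L₁ L₂))
           (sym (sumSubs-∷ (λ S → sumSubs (λ T → f (S ++ T)) L₂) x L₁)))

sumSubs-map : ∀ {A B : Set} (f : List B → ℤ) (h : A → B) L → sumSubs f (map h L) ≡ sumSubs (f ∘ map h) L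
sumSubs-map f h []      = refl
sumSubs-map f h (x ∷ L) =
  trans (sumSubs-∷ f (h x) (map h L))
    (trans (cong₂ _+_ (sumSubs-map f h L) (sumSubs-map (f ∘ (h x ∷_)) h L))
           (sym (sumSubs-∷ (f ∘ map h) x L)))

-- Formal power series

Series : Set
Series = ℕ → ℤ

one : Series
one zero    = + 1
one (suc _) = + 0

mul1+ : ℤ → Series → Series
mul1+ y f zero    = f zero
mul1+ y f (suc n) = f (suc n) + y * f n

div1+ : ℤ → Series → Series
div1+ z f zero    = f zero
div1+ z f (suc n) = f (suc n) - z * div1+ z f n

mul1+s : List ℤ → Series → Series
mul1+s []      f = f
mul1+s (y ∷ P) f = mul1+ y (mul1+s P f)

div1+s : List ℤ → Series → Series
div1+s []      f = f
div1+s (z ∷ M) f = div1+ z (div1+s M f)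

-- Coefficient n of ∏_{y ∈ P} (1 + y x) / ∏_{z ∈ M} (1 + z x) is e_n[P − M], the elementary
-- symmetric function of the virtual alphabet P − M.
elemGF : List ℤ → List ℤ → Series
elemGF P M = mul1+s P (div1+s M one)

derivative : Series → Series
derivative f n = + suc n * f (suc n)

record Linear (O : Series → Series) : Set where
  field
    resp-≗ : ∀ {f g} → f ≗ g → O f ≗ O g
    +-hom  : ∀ f g → O (λ n → f n + g n) ≗ λ n → O f n + O g n
    *-hom  : ∀ c f → O (λ n → c * f n) ≗ λ n → c * O f n
    0-hom  : O (λ _ → + 0) ≗ λ _ → + 0

open Linear

mul1+-linear : ∀ y → Linear (mul1+ y)
resp-≗ (mul1+-linear y) e zero    = e zero
resp-≗ (mul1+-linear y) e (suc n) = cong₂ (λ a b → a + y * b) (e (suc n)) (e n)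
+-hom  (mul1+-linear y) f g zero    = refl
+-hom  (mul1+-linear y) f g (suc n) = law (f (suc n)) (g (suc n)) (f n) (g n) y
  where
    law : ∀ a b c d y → (a + b) + y * (c + d) ≡ (a + y * c) + (b + y * d)
    law = solve-∀
*-hom  (mul1+-linear y) c f zero    = refl
*-hom  (mul1+-linear y) c f (suc n) = law c (f (suc n)) y (f n)
  where
    law : ∀ c a y b → c * a + y * (c * b) ≡ c * (a + y * b)
    law = solve-∀
0-hom  (mul1+-linear y) zero    = refl
0-hom  (mul1+-linear y) (suc n) = cong (_+_ (+ 0)) (ℤP.*-zeroʳ y)

div1+-linear : ∀ z → Linear (div1+ z)
resp-≗ (div1+-linear z) e zero    = e zero
resp-≗ (div1+-linear z) e (suc n) = cong₂ (λ a b → a - z * b) (e (suc n)) (resp-≗ (div1+-linear z) e n)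
+-hom  (div1+-linear z) f g zero    = refl
+-hom  (div1+-linear z) f g (suc n) =
  trans (cong (λ b → f (suc n) + g (suc n) - z * b) (+-hom (div1+-linear z) f g n))
        (law (f (suc n)) (g (suc n)) (div1+ z f n) (div1+ z g n) z)
  where
    law : ∀ a b c d z → (a + b) - z * (c + d) ≡ (a - z * c) + (b - z * d)
    law = solve-∀
*-hom  (div1+-linear z) c f zero    = refl
*-hom  (div1+-linear z) c f (suc n) =
  trans (cong (λ b → c * f (suc n) - z * b) (*-hom (div1+-linear z) c f n)) (law c (f (suc n)) z (div1+ z f n))
  where
    law : ∀ c a z b → c * a - z * (c * b) ≡ c * (a - z * b)
    law = solve-∀
0-hom  (div1+-linear z) zero    = refl
0-hom  (div1+-linear z) (suc n) =
  trans (cong (λ b → + 0 - z * b) (0-hom (div1+-linear z) n)) (cong (λ b → + 0 - b) (ℤP.*-zeroʳ z))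

id-linear : Linear (λ f → f)
resp-≗ id-linear e = e
+-hom  id-linear f g n = refl
*-hom  id-linear c f n = refl
0-hom  id-linear n = refl

∘-linear : ∀ {O O′} → Linear O → Linear O′ → Linear (O ∘ O′)
resp-≗ (∘-linear L L′) e = resp-≗ L (resp-≗ L′ e)
+-hom  (∘-linear {O′ = O′} L L′) f g n = trans (resp-≗ L (+-hom L′ f g) n) (+-hom L (O′ f) (O′ g) n)
*-hom  (∘-linear {O′ = O′} L L′) c f n = trans (resp-≗ L (*-hom L′ c f) n) (*-hom L c (O′ f) n)
0-hom  (∘-linear L L′) n = trans (resp-≗ L (0-hom L′) n) (0-hom L n)

mul1+s-linear : ∀ P → Linear (mul1+s P)
mul1+s-linear []      = id-linear
mul1+s-linear (y ∷ P) = ∘-linear (mul1+-linear y) (mul1+s-linear P)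

linear-sumℤ : ∀ {O} → Linear O → ∀ {A : Set} (c : A → ℤ) (h : A → Series) L →
  O (λ n → sumℤ (map (λ a → c a * h a n) L)) ≗ λ n → sumℤ (map (λ a → c a * O (h a) n) L)
linear-sumℤ Lo c h []      n = 0-hom Lo n
linear-sumℤ Lo c h (a ∷ L) n =
  trans (+-hom Lo (λ k → c a * h a k) (λ k → sumℤ (map (λ a → c a * h a k) L)) n)
        (cong₂ _+_ (*-hom Lo (c a) (h a) n) (linear-sumℤ Lo c h L n))

mul1+-div1+ : ∀ y f → mul1+ y (div1+ y f) ≗ f
mul1+-div1+ y f zero    = refl
mul1+-div1+ y f (suc n) = m-n+n≡m (f (suc n)) (y * div1+ y f n)

div1+-mul1+ : ∀ y f → div1+ y (mul1+ y f) ≗ f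
div1+-mul1+ y f zero    = refl
div1+-mul1+ y f (suc n) =
  trans (cong (λ b → f (suc n) + y * f n - y * b) (div1+-mul1+ y f n)) (m+n-n≡m (f (suc n)) (y * f n))

mul1+-comm : ∀ a b f → mul1+ a (mul1+ b f) ≗ mul1+ b (mul1+ a f)
mul1+-comm a b f zero          = refl
mul1+-comm a b f (suc zero)    = law (f 1) (f 0) a b
  where
    law : ∀ u v a b → u + b * v + a * v ≡ u + a * v + b * v
    law = solve-∀
mul1+-comm a b f (suc (suc n)) = law (f (suc (suc n))) (f (suc n)) (f n) a b
  where
    law : ∀ u v w a b → u + b * v + a * (v + b * w) ≡ u + a * v + b * (v + a * w)
    law = solve-∀

mul1+-div1+-comm : ∀ a b f → mul1+ a (div1+ b f) ≗ div1+ b (mul1+ a f)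
mul1+-div1+-comm a b f n = sym (begin
  div1+ b (mul1+ a f) n                       ≡⟨ resp-≗ (div1+-linear b) (resp-≗ (mul1+-linear a) (sym ∘ mul1+-div1+ b f)) n ⟩
  div1+ b (mul1+ a (mul1+ b (div1+ b f))) n   ≡⟨ resp-≗ (div1+-linear b) (mul1+-comm a b (div1+ b f)) n ⟩
  div1+ b (mul1+ b (mul1+ a (div1+ b f))) n   ≡⟨ div1+-mul1+ b (mul1+ a (div1+ b f)) n ⟩
  mul1+ a (div1+ b f) n                       ∎)
  where open ≡-Reasoning

div1+-comm : ∀ a b f → div1+ a (div1+ b f) ≗ div1+ b (div1+ a f)
div1+-comm a b f n = sym (begin
  div1+ b (div1+ a f) n            ≡⟨ resp-≗ (div1+-linear b) (resp-≗ (div1+-linear a) f≗) n ⟩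
  div1+ b (div1+ a (mul1+ a (mul1+ b g))) n ≡⟨ resp-≗ (div1+-linear b) (div1+-mul1+ a (mul1+ b g)) n ⟩
  div1+ b (mul1+ b g) n            ≡⟨ div1+-mul1+ b g n ⟩
  g n                              ∎)
  where
    open ≡-Reasoning
    g = div1+ a (div1+ b f)
    f≗ : f ≗ mul1+ a (mul1+ b g)
    f≗ k = sym (begin
      mul1+ a (mul1+ b g) k          ≡⟨ mul1+-comm a b g k ⟩
      mul1+ b (mul1+ a g) k          ≡⟨ resp-≗ (mul1+-linear b) (mul1+-div1+ a (div1+ b f)) k ⟩
      mul1+ b (div1+ b f) k          ≡⟨ mul1+-div1+ b f k ⟩
      f k                            ∎)

mul1+-mul1+s-comm : ∀ a P f → mul1+ a (mul1+s P f) ≗ mul1+s P (mul1+ a f)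
mul1+-mul1+s-comm a []      f n = refl
mul1+-mul1+s-comm a (b ∷ P) f n =
  trans (mul1+-comm a b (mul1+s P f) n) (resp-≗ (mul1+-linear b) (mul1+-mul1+s-comm a P f) n)

mul1+s-div1+-comm : ∀ P z f → mul1+s P (div1+ z f) ≗ div1+ z (mul1+s P f)
mul1+s-div1+-comm []      z f n = refl
mul1+s-div1+-comm (y ∷ P) z f n =
  trans (resp-≗ (mul1+-linear y) (mul1+s-div1+-comm P z f) n) (mul1+-div1+-comm y z (mul1+s P f) n)

derivative-cong : ∀ {f g} → f ≗ g → derivative f ≗ derivative g
derivative-cong e n = cong (+ suc n *_) (e (suc n))

derivative-mul1+ : ∀ y f → derivative (mul1+ y f) ≗ λ n → y * f n + mul1+ y (derivative f) n
derivative-mul1+ y f zero    = law₀ (f 1) (f 0) y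
  where
    law₀ : ∀ a b y → + 1 * (a + y * b) ≡ y * b + + 1 * a
    law₀ = solve-∀
derivative-mul1+ y f (suc n) = law (+ suc n) (f (suc (suc n))) (f (suc n)) y
  where
    law : ∀ N a b y → (+ 1 + N) * (a + y * b) ≡ y * b + ((+ 1 + N) * a + y * (N * b))
    law = solve-∀

-- Obtained from derivative-mul1+ by writing f = (1 + z x) (f / (1 + z x)).
derivative-div1+ : ∀ z f → derivative (div1+ z f) ≗ λ n → div1+ z (derivative f) n + (- z) * div1+ z (div1+ z f) n
derivative-div1+ z f n = begin
  derivative g n                                    ≡⟨ div1+-mul1+ z (derivative g) n ⟨
  div1+ z (mul1+ z (derivative g)) n                ≡⟨ resp-≗ (div1+-linear z) mul1+-derivative n ⟩
  div1+ z (λ k → derivative f k + (- z) * g k) n    ≡⟨ +-hom (div1+-linear z) (derivative f) (λ k → (- z) * g k) n ⟩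
  div1+ z (derivative f) n + div1+ z (λ k → (- z) * g k) n
                                                    ≡⟨ cong (_+_ (div1+ z (derivative f) n)) (*-hom (div1+-linear z) (- z) g n) ⟩
  div1+ z (derivative f) n + (- z) * div1+ z g n    ∎
  where
    open ≡-Reasoning
    g = div1+ z f
    solve-for : ∀ a b c y → a ≡ y * b + c → c ≡ a + (- y) * b
    solve-for a b c y e = trans (law a b c y) (cong (λ w → w + (- y) * b) (sym e))
      where
        law : ∀ a b c y → c ≡ (y * b + c) + (- y) * b
        law = solve-∀
    mul1+-derivative : mul1+ z (derivative g) ≗ λ k → derivative f k + (- z) * g k
    mul1+-derivative k = solve-for (derivative f k) (g k) (mul1+ z (derivative g) k) z
      (trans (derivative-cong (sym ∘ mul1+-div1+ z f) k) (derivative-mul1+ z g k))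

derivative-mul1+s : ∀ P F → derivative (mul1+s P F) ≗
  λ n → sumℤ (map (λ y → y * mul1+s P (div1+ y F) n) P) + mul1+s P (derivative F) n
derivative-mul1+s []      F n = sym (ℤP.+-identityˡ _)
derivative-mul1+s (a ∷ P) F n = begin
  derivative (mul1+ a G) n
    ≡⟨ derivative-mul1+ a G n ⟩
  a * G n + mul1+ a (derivative G) n
    ≡⟨ cong (_+_ (a * G n)) (resp-≗ (mul1+-linear a) (derivative-mul1+s P F) n) ⟩
  a * G n + mul1+ a (λ k → terms k + mul1+s P (derivative F) k) n
    ≡⟨ cong (_+_ (a * G n)) (+-hom (mul1+-linear a) terms (mul1+s P (derivative F)) n) ⟩
  a * G n + (mul1+ a terms n + mul1+s (a ∷ P) (derivative F) n)
    ≡⟨ cong (λ s → a * G n + (s + mul1+s (a ∷ P) (derivative F) n)) (linear-sumℤ (mul1+-linear a) (λ y → y) _ P n) ⟩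
  a * G n + (terms′ + mul1+s (a ∷ P) (derivative F) n)
    ≡⟨ ℤP.+-assoc (a * G n) terms′ _ ⟨
  (a * G n + terms′) + mul1+s (a ∷ P) (derivative F) n
    ≡⟨ cong (λ w → (a * w + terms′) + mul1+s (a ∷ P) (derivative F) n) G≗ ⟨
  (a * mul1+s (a ∷ P) (div1+ a F) n + terms′) + mul1+s (a ∷ P) (derivative F) n ∎
  where
    open ≡-Reasoning
    G = mul1+s P F
    terms : Series
    terms k = sumℤ (map (λ y → y * mul1+s P (div1+ y F) k) P)
    terms′ = sumℤ (map (λ y → y * mul1+s (a ∷ P) (div1+ y F) n) P)
    G≗ : mul1+s (a ∷ P) (div1+ a F) n ≡ G n
    G≗ = trans (mul1+-mul1+s-comm a P (div1+ a F) n) (resp-≗ (mul1+s-linear P) (mul1+-div1+ a F) n)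

derivative-div1+s : ∀ M → derivative (div1+s M one) ≗ λ n → sumℤ (map (λ z → (- z) * div1+ z (div1+s M one) n) M)
derivative-div1+s []      n = ℤP.*-zeroʳ (+ suc n)
derivative-div1+s (b ∷ M) n = begin
  derivative (div1+ b G) n
    ≡⟨ derivative-div1+ b G n ⟩
  div1+ b (derivative G) n + last
    ≡⟨ cong (_+ last) (resp-≗ (div1+-linear b) (derivative-div1+s M) n) ⟩
  div1+ b (λ k → sumℤ (map (λ z → (- z) * div1+ z G k) M)) n + last
    ≡⟨ cong (_+ last) (linear-sumℤ (div1+-linear b) -_ (λ z → div1+ z G) M n) ⟩
  sumℤ (map (λ z → (- z) * div1+ b (div1+ z G) n) M) + last
    ≡⟨ cong (_+ last) (cong sumℤ (ListP.map-cong (λ z → cong ((- z) *_) (div1+-comm b z G n)) M)) ⟩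
  sumℤ (map (λ z → (- z) * div1+ z (div1+ b G) n) M) + last
    ≡⟨ ℤP.+-comm _ last ⟩
  last + sumℤ (map (λ z → (- z) * div1+ z (div1+ b G) n) M) ∎
  where
    open ≡-Reasoning
    G = div1+s M one
    last = (- b) * div1+ b (div1+ b G) n

newton : ∀ P M n → derivative (elemGF P M) n ≡
  sumℤ (map (λ y → y * elemGF P (y ∷ M) n) P) + sumℤ (map (λ z → (- z) * elemGF P (z ∷ M) n) M)
newton P M n =
  trans (derivative-mul1+s P F n)
        (cong (_+_ (sumℤ (map (λ y → y * elemGF P (y ∷ M) n) P)))
              (trans (resp-≗ (mul1+s-linear P) (derivative-div1+s M) n)
                     (linear-sumℤ (mul1+s-linear P) -_ (λ z → div1+ z F) M n)))
  where F = div1+s M one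

elemGF-0 : ∀ P M → elemGF P M 0 ≡ + 1
elemGF-0 []      []      = refl
elemGF-0 []      (z ∷ M) = elemGF-0 [] M
elemGF-0 (y ∷ P) M       = elemGF-0 P M

elemSym-[] : elemSym [] ≗ one
elemSym-[] zero    = refl
elemSym-[] (suc n) = refl

elemSym-∷ : ∀ y P → elemSym (y ∷ P) ≗ mul1+ y (elemSym P)
elemSym-∷ y P k = trans (expand k) (by-degree k)
  where
    subsOfSize : ℕ → List (List ℤ)
    subsOfSize k = filterᵇ (λ s → suc (length s) ≡ᵇ k) (subs P)
    expand : ∀ k → elemSym (y ∷ P) k ≡ elemSym P k + y * sumℤ (map prodℤ (subsOfSize k))
    expand k = begin
      sumℤ (map prodℤ (filterᵇ p (subs P ++ map (y ∷_) (subs P))))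
        ≡⟨ cong (sumℤ ∘ map prodℤ) (filterᵇ-++ p (subs P) _) ⟩
      sumℤ (map prodℤ (filterᵇ p (subs P) ++ filterᵇ p (map (y ∷_) (subs P))))
        ≡⟨ cong (λ l → sumℤ (map prodℤ (filterᵇ p (subs P) ++ l))) (filterᵇ-map p (y ∷_) (subs P)) ⟩
      sumℤ (map prodℤ (filterᵇ p (subs P) ++ map (y ∷_) (subsOfSize k)))
        ≡⟨ cong sumℤ (ListP.map-++ prodℤ (filterᵇ p (subs P)) _) ⟩
      sumℤ (map prodℤ (filterᵇ p (subs P)) ++ map prodℤ (map (y ∷_) (subsOfSize k)))
        ≡⟨ sumℤ-++ (map prodℤ (filterᵇ p (subs P))) _ ⟩
      elemSym P k + sumℤ (map prodℤ (map (y ∷_) (subsOfSize k)))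
        ≡⟨ cong (_+_ (elemSym P k)) (trans (cong sumℤ (sym (ListP.map-∘ (subsOfSize k))))
                                           (sumℤ-map-*ˡ y prodℤ (subsOfSize k))) ⟩
      elemSym P k + y * sumℤ (map prodℤ (subsOfSize k)) ∎
      where
        open ≡-Reasoning
        p = λ (s : List ℤ) → length s ≡ᵇ k
    by-degree : ∀ k → elemSym P k + y * sumℤ (map prodℤ (subsOfSize k)) ≡ mul1+ y (elemSym P) k
    by-degree zero =
      trans (cong (λ l → elemSym P 0 + y * sumℤ (map prodℤ l)) (filterᵇ-none _ (subs P) (λ _ → refl)))
            (trans (cong (_+_ (elemSym P 0)) (ℤP.*-zeroʳ y)) (ℤP.+-identityʳ _))
    by-degree (suc n) = refl

elemSym≗mul1+s : ∀ P → elemSym P ≗ mul1+s P one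
elemSym≗mul1+s []      = elemSym-[]
elemSym≗mul1+s (y ∷ P) n = trans (elemSym-∷ y P n) (resp-≗ (mul1+-linear y) (elemSym≗mul1+s P) n)

applyUpTo-∘ : ∀ {A B : Set} (g : A → B) (f : ℕ → A) n → applyUpTo (g ∘ f) n ≡ map g (applyUpTo f n)
applyUpTo-∘ g f zero    = refl
applyUpTo-∘ g f (suc n) = cong (g (f 0) ∷_) (applyUpTo-∘ g (f ∘ suc) n)

enn-suc : ∀ n xs t → enn (suc (suc n)) xs t ≡ elemSym xs (suc n) - t * enn (suc n) xs t
enn-suc n xs t = begin
  (- t) ^ 0 * elemSym xs (suc n) + sumℤ (map h (map suc (applyUpTo suc (suc n))))
    ≡⟨ cong₂ _+_ (ℤP.*-identityˡ (elemSym xs (suc n)))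
                 (cong (λ l → sumℤ (map h (map suc l))) (applyUpTo-∘ suc (λ k → k) (suc n))) ⟩
  elemSym xs (suc n) + sumℤ (map h (map suc (map suc U)))
    ≡⟨ cong (λ l → elemSym xs (suc n) + sumℤ l)
            (trans (sym (ListP.map-∘ {g = h} {f = suc} (map suc U))) (sym (ListP.map-∘ {g = h ∘ suc} {f = suc} U))) ⟩
  elemSym xs (suc n) + sumℤ (map (λ j → (- t) ^ suc j * g (suc j)) U)
    ≡⟨ cong (λ l → elemSym xs (suc n) + sumℤ l) (ListP.map-cong (λ j → ℤP.*-assoc (- t) ((- t) ^ j) (g (suc j))) U) ⟩
  elemSym xs (suc n) + sumℤ (map (λ j → (- t) * ((- t) ^ j * g (suc j))) U)
    ≡⟨ cong (_+_ (elemSym xs (suc n))) (sumℤ-map-*ˡ (- t) (λ j → (- t) ^ j * g (suc j)) U) ⟩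
  elemSym xs (suc n) + (- t) * sumℤ (map (λ j → (- t) ^ j * g (suc j)) U)
    ≡⟨ cong (λ s → elemSym xs (suc n) + (- t) * sumℤ s) (ListP.map-∘ {g = λ k → (- t) ^ (k ∸ 1) * g k} {f = suc} U) ⟩
  elemSym xs (suc n) + (- t) * enn (suc n) xs t
    ≡⟨ cong (_+_ (elemSym xs (suc n))) (ℤP.neg-distribˡ-* t (enn (suc n) xs t)) ⟨
  elemSym xs (suc n) - t * enn (suc n) xs t ∎
  where
    open ≡-Reasoning
    U = upTo (suc n)
    h = λ k → (- t) ^ (k ∸ 1) * elemSym xs (suc (suc n) ∸ k)
    g = λ k → elemSym xs (suc n ∸ k)

enn≡div1+ : ∀ xs t n → enn (suc n) xs t ≡ div1+ t (elemSym xs) n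
enn≡div1+ xs t zero    = trans (ℤP.+-identityʳ _) (ℤP.*-identityˡ _)
enn≡div1+ xs t (suc n) = trans (enn-suc n xs t) (cong (λ w → elemSym xs (suc n) - t * w) (enn≡div1+ xs t n))

enn≡elemGF : ∀ m xs t → enn (suc m) xs t ≡ elemGF xs [ t ] m
enn≡elemGF m xs t = sym (begin
  mul1+s xs (div1+ t one) m   ≡⟨ mul1+s-div1+-comm xs t one m ⟩
  div1+ t (mul1+s xs one) m   ≡⟨ resp-≗ (div1+-linear t) (sym ∘ elemSym≗mul1+s xs) m ⟩
  div1+ t (elemSym xs) m      ≡⟨ enn≡div1+ xs t m ⟨
  enn (suc m) xs t            ∎)
  where open ≡-Reasoning

-- Connectivity

Relᵇ : ℕ → Set
Relᵇ n = Fin n → Fin n → Bool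

record IsEquivalenceᵇ {n} (C : Relᵇ n) : Set where
  field
    reflᵇ  : ∀ x → C x x ≡ true
    symᵇ   : ∀ x y → C x y ≡ true → C y x ≡ true
    transᵇ : ∀ x y z → C x y ≡ true → C y z ≡ true → C x z ≡ true

open IsEquivalenceᵇ

module _ {n : ℕ} where

  eqF-true⁻ : ∀ (i j : Fin n) → eqF i j ≡ true → i ≡ j
  eqF-true⁻ i j e with i Fin.≟ j
  ... | yes i≡j = i≡j

  eqF-refl : ∀ (i : Fin n) → eqF i i ≡ true
  eqF-refl i with i Fin.≟ i
  ... | yes _   = refl
  ... | no  i≢i = ⊥-elim (i≢i refl)

  eqF-false⁺ : ∀ {i j : Fin n} → i ≢ j → eqF i j ≡ false
  eqF-false⁺ {i} {j} i≢j with i Fin.≟ j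
  ... | yes i≡j = ⊥-elim (i≢j i≡j)
  ... | no  _   = refl

  Edge : Graph n → Fin n → Fin n → Set
  Edge S a b = adj S a b ≡ true

  Path : Graph n → Fin n → Fin n → Set
  Path S = Star (Edge S)

  adj-sym : ∀ (S : Graph n) a b → adj S a b ≡ adj S b a
  adj-sym S a b = any-cong (λ e → BoolP.∨-comm (eqF (proj₁ e) a ∧ eqF (proj₂ e) b) _) S

  reachIn-mono : ∀ k {S : Graph n} {i} j → reachIn k S i j ≡ true → reachIn (suc k) S i j ≡ true
  reachIn-mono k j = ∨-trueˡ _

  reachIn-refl : ∀ k (S : Graph n) i → reachIn k S i i ≡ true
  reachIn-refl zero    S i = eqF-refl i
  reachIn-refl (suc k) S i = reachIn-mono k i (reachIn-refl k S i)

  reachIn-step : ∀ k {S : Graph n} {i} m j → reachIn k S i m ≡ true → Edge S m j → reachIn (suc k) S i j ≡ true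
  reachIn-step k {S} {i} m j r e =
    ∨-trueʳ (reachIn k S i j) (any-true⁺ (λ m → reachIn k S i m ∧ adj S m j) (∈-allFin m) (∧-true⁺ r e))

  reachIn-sound : ∀ k (S : Graph n) i j → reachIn k S i j ≡ true → Path S i j
  reachIn-sound zero S i j e with eqF-true⁻ i j e
  ... | refl = ε
  reachIn-sound (suc k) S i j e with ∨-true⁻ (reachIn k S i j) e
  ... | inj₁ r = reachIn-sound k S i j r
  ... | inj₂ r with any-true⁻ (λ m → reachIn k S i m ∧ adj S m j) (allFin n) r
  ...   | m , rm , _ with ∧-true⁻ (reachIn k S i m) rm
  ...     | r′ , e′ = reachIn-sound k S i m r′ ◅◅ (e′ ◅ ε)

  reachIn-cong : ∀ k {S S′ : Graph n} → (∀ a b → adj S a b ≡ adj S′ a b) →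
                 ∀ i j → reachIn k S i j ≡ reachIn k S′ i j
  reachIn-cong zero    e i j = refl
  reachIn-cong (suc k) e i j =
    cong₂ _∨_ (reachIn-cong k e i j) (any-cong (λ m → cong₂ _∧_ (reachIn-cong k e i m) (e m j)) (allFin n))

  module _ (S : Graph n) (i : Fin n) where

    Saturated : ℕ → Set
    Saturated k = ∀ j → reachIn (suc k) S i j ≡ true → reachIn k S i j ≡ true

    saturated-suc : ∀ k → Saturated k → Saturated (suc k)
    saturated-suc k sat j e with ∨-true⁻ (reachIn (suc k) S i j) e
    ... | inj₁ r = r
    ... | inj₂ r with any-true⁻ (λ m → reachIn (suc k) S i m ∧ adj S m j) (allFin n) r
    ...   | m , rm , _ with ∧-true⁻ (reachIn (suc k) S i m) rm
    ...     | r′ , e′ = reachIn-step k m j (sat m r′) e′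

    private
      newAt : ℕ → Fin n → Bool
      newAt k j = reachIn (suc k) S i j ∧ not (reachIn k S i j)

    -- Until it saturates, the set reached from i grows at every step; it has at most n elements.
    saturated-or-growing : ∀ k → Saturated k ⊎ suc k ≤ count (reachIn k S i) (allFin n)
    saturated-or-growing zero =
      inj₂ (ℕP.≤-trans (s≤s z≤n) (count-strict (λ _ ()) (∈-allFin i) refl (eqF-refl i)))
    saturated-or-growing (suc k) with saturated-or-growing k
    ... | inj₁ sat = inj₁ (saturated-suc k sat)
    ... | inj₂ grows with any (newAt k) (allFin n) in e
    ...   | false = inj₁ (saturated-suc k no-new)
      where
        no-new : Saturated k
        no-new j r with bool-cases (reachIn k S i j)
        ... | inj₁ old = old
        ... | inj₂ ¬old = ⊥-elim (BoolP.not-¬ (any-true⁺ (newAt k) (∈-allFin j) (∧-true⁺ r (cong not ¬old))) e)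
    ...   | true with any-true⁻ (newAt k) (allFin n) e
    ...     | j , newj , _ with ∧-true⁻ (reachIn (suc k) S i j) newj
    ...       | r , ¬old = inj₂ (ℕP.≤-trans (s≤s grows)
                                  (count-strict (reachIn-mono k) (∈-allFin j) (not-true⁻ ¬old) r))

    saturated-at-n : Saturated n
    saturated-at-n with saturated-or-growing n
    ... | inj₁ sat   = sat
    ... | inj₂ grows = ⊥-elim (ℕP.<-irrefl refl (ℕP.≤-trans grows
                         (ℕP.≤-trans (ListP.length-filter (T? ∘ reachIn n S i) (allFin n))
                                     (ℕP.≤-reflexive (ListP.length-tabulate (λ x → x))))))

  conn-step : ∀ (S : Graph n) {i} m j → conn S i m ≡ true → Edge S m j → conn S i j ≡ true
  conn-step S {i} m j c e = saturated-at-n S i j (reachIn-step n m j c e)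

  conn-extend : ∀ (S : Graph n) {i m j} → conn S i m ≡ true → Path S m j → conn S i j ≡ true
  conn-extend S c ε       = c
  conn-extend S c (e ◅ p) = conn-extend S (conn-step S _ _ c e) p

  path⇒conn : ∀ (S : Graph n) {i j} → Path S i j → conn S i j ≡ true
  path⇒conn S = conn-extend S (reachIn-refl n S _)

  conn⇒path : ∀ (S : Graph n) i j → conn S i j ≡ true → Path S i j
  conn⇒path S = reachIn-sound n S

  conn-isEquivalenceᵇ : ∀ (S : Graph n) → IsEquivalenceᵇ (conn S)
  reflᵇ  (conn-isEquivalenceᵇ S) = reachIn-refl n S
  symᵇ   (conn-isEquivalenceᵇ S) x y c =
    path⇒conn S (Star.reverse (λ {a} {b} e → trans (adj-sym S b a) e) (conn⇒path S x y c))
  transᵇ (conn-isEquivalenceᵇ S) x y z c d = path⇒conn S (conn⇒path S x y c ◅◅ conn⇒path S y z d)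

  conn-cong : ∀ {S S′ : Graph n} → (∀ a b → adj S a b ≡ adj S′ a b) → ∀ i j → conn S i j ≡ conn S′ i j
  conn-cong = reachIn-cong n

filterᵇ-tabulate-none : ∀ {A : Set} {m} (g : Fin m → A) (p : A → Bool) →
  (∀ j → p (g j) ≡ false) → filterᵇ p (tabulate g) ≡ []
filterᵇ-tabulate-none {m = zero}  g p h = refl
filterᵇ-tabulate-none {m = suc m} g p h =
  trans (filterᵇ-reject p _ (h Fin.zero)) (filterᵇ-tabulate-none (g ∘ Fin.suc) p (h ∘ Fin.suc))

filterᵇ-tabulate-unique : ∀ {A : Set} {m} (g : Fin m → A) (p : A → Bool) {k} →
  (∀ j → p (g j) ≡ true → j ≡ k) → p (g k) ≡ true → filterᵇ p (tabulate g) ≡ [ g k ]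
filterᵇ-tabulate-unique g p {Fin.zero} uniq pk =
  trans (filterᵇ-accept p _ pk)
        (cong (g Fin.zero ∷_) (filterᵇ-tabulate-none (g ∘ Fin.suc) p
          λ j → BoolP.¬-not λ pj → FinP.0≢1+n (sym (uniq (Fin.suc j) pj))))
filterᵇ-tabulate-unique g p {Fin.suc k} uniq pk =
  trans (filterᵇ-reject p _ (BoolP.¬-not λ p0 → FinP.0≢1+n (uniq Fin.zero p0)))
        (filterᵇ-tabulate-unique (g ∘ Fin.suc) p (λ j pj → FinP.suc-injective (uniq (Fin.suc j) pj)) pk)

module _ {n : ℕ} where

  classSize : Relᵇ n → Fin n → ℕ
  classSize C u = count (C u) (allFin n)

  isClassRep : Relᵇ n → Fin n → Bool
  isClassRep C u = not (any (λ j → (toℕ j <ᵇ toℕ u) ∧ C u j) (allFin n))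

  classSize-row : ∀ (C C′ : Relᵇ n) u → C u ≗ C′ u → classSize C u ≡ classSize C′ u
  classSize-row C C′ u e = cong length (filterᵇ-cong e (allFin n))

  isClassRep-row : ∀ (C C′ : Relᵇ n) u → C u ≗ C′ u → isClassRep C u ≡ isClassRep C′ u
  isClassRep-row C C′ u e = cong not (any-cong (λ j → cong ((toℕ j <ᵇ toℕ u) ∧_) (e j)) (allFin n))

  module _ {C : Relᵇ n} (E : IsEquivalenceᵇ C) where

    symᵇ-≡ : ∀ x y → C x y ≡ C y x
    symᵇ-≡ x y = true⇔true⇒≡ (symᵇ E x y) (symᵇ E y x)

    row-≡ : ∀ {x y} → C x y ≡ true → C x ≗ C y
    row-≡ {x} {y} c z = true⇔true⇒≡ (transᵇ E y x z (symᵇ E x y c)) (transᵇ E x y z c)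

    classSize-≡ : ∀ {x y} → C x y ≡ true → classSize C x ≡ classSize C y
    classSize-≡ c = cong length (filterᵇ-cong (row-≡ c) (allFin n))

    classSize-pos : ∀ x → 1 ≤ classSize C x
    classSize-pos x = ℕP.≤-trans (s≤s z≤n) (count-strict (λ _ ()) (∈-allFin x) refl (reflᵇ E x))

    classRep-below : ∀ k x → toℕ x < k → ∃ λ r → C x r ≡ true × isClassRep C r ≡ true
    classRep-below (suc k) x x<k with isClassRep C x in rep
    ... | true  = x , reflᵇ E x , rep
    ... | false with any-true⁻ _ (allFin n) (not-false⁻ rep)
    ...   | j , pj , _ with ∧-true⁻ (toℕ j <ᵇ toℕ x) pj
    ...     | j<x , c
      with classRep-below k j (ℕP.≤-trans (ℕP.<ᵇ⇒< (toℕ j) (toℕ x) (Equivalence.from BoolP.T-≡ j<x)) (ℕP.≤-pred x<k))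
    ...       | r , cr , rr = r , transᵇ E x j r c cr , rr

    classRep : ∀ x → ∃ λ r → C x r ≡ true × isClassRep C r ≡ true
    classRep x = classRep-below (suc (toℕ x)) x ℕP.≤-refl

    classRep-minimal : ∀ {r r′} → isClassRep C r ≡ true → C r r′ ≡ true → ¬ (toℕ r′ < toℕ r)
    classRep-minimal {r} {r′} rep c r′<r =
      BoolP.not-¬ (any-true⁺ (λ j → (toℕ j <ᵇ toℕ r) ∧ C r j) (∈-allFin r′)
                             (∧-true⁺ (Equivalence.to BoolP.T-≡ (ℕP.<⇒<ᵇ r′<r)) c))
                  (not-true⁻ rep)

    classRep-unique : ∀ {r r′} → isClassRep C r ≡ true → isClassRep C r′ ≡ true → C r r′ ≡ true → r ≡ r′
    classRep-unique {r} {r′} rep rep′ c with ℕP.<-cmp (toℕ r) (toℕ r′)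
    ... | tri< r<r′ _ _ = ⊥-elim (classRep-minimal rep′ (symᵇ E r r′ c) r<r′)
    ... | tri≈ _ r≡r′ _ = FinP.toℕ-injective r≡r′
    ... | tri> _ _ r′<r = ⊥-elim (classRep-minimal rep c r′<r)

    prodℤ-classRep : ∀ (P : Fin n → Bool) (f : ℕ → ℤ) x → (∀ u → P u ≡ isClassRep C u ∧ C x u) →
      prodℤ (map (f ∘ classSize C) (filterᵇ P (allFin n))) ≡ f (classSize C x) * + 1
    prodℤ-classRep P f x P≡ with classRep x
    ... | r , cr , rr =
      trans (cong (prodℤ ∘ map (f ∘ classSize C))
                  (filterᵇ-tabulate-unique (λ u → u) P uniq (trans (P≡ r) (∧-true⁺ rr cr))))
            (cong (λ k → f k * + 1) (classSize-≡ (symᵇ E x r cr)))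
      where
        uniq : ∀ u → P u ≡ true → u ≡ r
        uniq u pu with ∧-true⁻ (isClassRep C u) (trans (sym (P≡ u)) pu)
        ... | ru , cu = classRep-unique ru rr (transᵇ E u x r (symᵇ E x u cu) cr)

module _ {n : ℕ} where

  mergeClasses : Fin n → Fin n → Relᵇ n → Relᵇ n
  mergeClasses i v C x y = C x y ∨ ((C x i ∨ C x v) ∧ (C y i ∨ C y v))

  module _ (H : Graph n) (i v : Fin n) where
    private
      C = conn H
      E = conn-isEquivalenceᵇ H
      H⁺ = H ++ [ (i , v) ]
      E⁺ = conn-isEquivalenceᵇ H⁺
      near : Fin n → Bool
      near x = C x i ∨ C x v

    adj-++-edge : ∀ a b → adj H⁺ a b ≡ adj H a b ∨ ((eqF i a ∧ eqF v b ∨ eqF i b ∧ eqF v a) ∨ false)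
    adj-++-edge a b = any-++ _ H [ (i , v) ]

    path-++-edge : ∀ {a b} → Path H a b → Path H⁺ a b
    path-++-edge = Star.map (λ {a} {b} e → trans (adj-++-edge a b) (∨-trueˡ _ e))

    near-resp : ∀ {x m} → C x m ≡ true → near m ≡ true → near x ≡ true
    near-resp {x} {m} c nm with ∨-true⁻ (C m i) nm
    ... | inj₁ cmi = ∨-trueˡ _ (transᵇ E x m i c cmi)
    ... | inj₂ cmv = ∨-trueʳ (C x i) (transᵇ E x m v c cmv)

    new-edge-near : ∀ a b → (eqF i a ∧ eqF v b ∨ eqF i b ∧ eqF v a) ∨ false ≡ true → near a ≡ true × near b ≡ true
    new-edge-near a b e with ∨-true⁻ (eqF i a ∧ eqF v b) (trans (sym (BoolP.∨-identityʳ _)) e)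
    ... | inj₁ iv with ∧-true⁻ (eqF i a) iv
    ...   | ia , vb rewrite eqF-true⁻ i a ia | eqF-true⁻ v b vb = ∨-trueˡ _ (reflᵇ E a) , ∨-trueʳ (C b a) (reflᵇ E b)
    new-edge-near a b e | inj₂ vi with ∧-true⁻ (eqF i b) vi
    ...   | ib , va rewrite eqF-true⁻ i b ib | eqF-true⁻ v a va = ∨-trueʳ (C a b) (reflᵇ E a) , ∨-trueˡ _ (reflᵇ E b)

    path⇒merge : ∀ {x y} → Path H⁺ x y → mergeClasses i v C x y ≡ true
    path⇒merge {x} ε = ∨-trueˡ _ (reflᵇ E x)
    path⇒merge {x} {y} (_◅_ {j = m} e p)
      with ∨-true⁻ (adj H x m) (trans (sym (adj-++-edge x m)) e) | ∨-true⁻ (C m y) (path⇒merge p)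
    ... | inj₁ old | inj₁ cmy  = ∨-trueˡ _ (transᵇ E x m y (path⇒conn H (old ◅ ε)) cmy)
    ... | inj₁ old | inj₂ near-my with ∧-true⁻ (near m) near-my
    ...   | nm , ny = ∨-trueʳ (C x y) (∧-true⁺ (near-resp (path⇒conn H (old ◅ ε)) nm) ny)
    path⇒merge {x} {y} (_◅_ {j = m} e p) | inj₂ new | inj₁ cmy with new-edge-near x m new
    ...   | nx , nm = ∨-trueʳ (C x y) (∧-true⁺ nx (near-resp (symᵇ E m y cmy) nm))
    path⇒merge {x} {y} (_◅_ {j = m} e p) | inj₂ new | inj₂ near-my with new-edge-near x m new
    ...   | nx , _ = ∨-trueʳ (C x y) (∧-true⁺ nx (proj₂ (∧-true⁻ (near m) near-my)))

    merge⇒conn : ∀ x y → mergeClasses i v C x y ≡ true → conn H⁺ x y ≡ true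
    merge⇒conn x y e with ∨-true⁻ (C x y) e
    ... | inj₁ cxy = lift cxy
      where
        lift : ∀ {a b} → C a b ≡ true → conn H⁺ a b ≡ true
        lift {a} {b} c = path⇒conn H⁺ (path-++-edge (conn⇒path H a b c))
    ... | inj₂ near-xy with ∧-true⁻ (near x) near-xy
    ...   | nx , ny = transᵇ E⁺ x v y (toV x nx) (symᵇ E⁺ y v (toV y ny))
      where
        iv : conn H⁺ i v ≡ true
        iv = path⇒conn H⁺
          (trans (adj-++-edge i v) (∨-trueʳ (adj H i v) (∨-trueˡ _ (∨-trueˡ _ (∧-true⁺ (eqF-refl i) (eqF-refl v))))) ◅ ε)
        toV : ∀ z → near z ≡ true → conn H⁺ z v ≡ true
        toV z nz with ∨-true⁻ (C z i) nz
        ... | inj₁ czi = transᵇ E⁺ z i v (path⇒conn H⁺ (path-++-edge (conn⇒path H z i czi))) iv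
        ... | inj₂ czv = path⇒conn H⁺ (path-++-edge (conn⇒path H z v czv))

    conn-++-edge : ∀ x y → conn H⁺ x y ≡ mergeClasses i v C x y
    conn-++-edge x y = true⇔true⇒≡ (path⇒merge ∘ conn⇒path H⁺ x y) (merge⇒conn x y)

-- Coning

module _ {n : ℕ} where

  awayProduct : (ℕ → ℤ) → Graph n → Fin n → ℤ
  awayProduct q S v = prodℤ (map (q ∘ compSize S) (filterᵇ (λ u → isRep S u ∧ not (conn S v u)) (allFin n)))

  componentProduct : (ℕ → ℤ) → Graph n → ℤ
  componentProduct q S = prodℤ (map (q ∘ compSize S) (filterᵇ (isRep S) (allFin n)))

  pointedX : Graph n → Fin n → (ℕ → ℤ) → (ℕ → ℤ) → ℤ
  pointedX G v q w = sumSubs (λ S → (- + 1) ^ length S * awayProduct q S v * w (compSize S v)) G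

  chromaticX : Graph n → (ℕ → ℤ) → ℤ
  chromaticX G q = sumSubs (λ S → (- + 1) ^ length S * componentProduct q S) G

module Cone (q : ℕ → ℤ) (t : ℤ) {n : ℕ} (v : Fin n) where

  q′ : ℕ → ℤ
  q′ k = q k - t ^ k

  classWeight : Bool → ℕ → ℤ
  classWeight b k = if b then q′ k else q k

  weight : Relᵇ n → List (Fin n) → Fin n → ℤ
  weight C L u = classWeight (any (C u) L) (classSize C u)

  awayFromV : Relᵇ n → Fin n → Bool
  awayFromV C u = isClassRep C u ∧ not (C v u)

  awayFromV-class-v : ∀ C u → C v u ≡ true → awayFromV C u ≡ false
  awayFromV-class-v C u e = trans (cong (λ b → isClassRep C u ∧ not b) e) (BoolP.∧-zeroʳ _)

  coneBody : Relᵇ n → List (Fin n) → ℤ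
  coneBody C L = prodℤ (map (weight C L) (filterᵇ (awayFromV C) (allFin n))) * t ^ (classSize C v ∸ 1)

  -- The closed form of the alternating sum over A ⊆ L of the terms of H plus the edges A × {v}
  -- (coneSum≡coneValue below), with C = conn H.  A class of H meeting L contributes q′ k: q k if
  -- it stays apart from v, minus t ^ k for being absorbed into the class of v.  Once the class of
  -- v meets L, the edge from that vertex to v changes no connectivity and the sum cancels in pairs.
  coneValue : Relᵇ n → List (Fin n) → ℤ
  coneValue C L = if any (C v) L then + 0 else coneBody C L

  coneValue-meets : ∀ C L → any (C v) L ≡ true → coneValue C L ≡ + 0
  coneValue-meets C L e rewrite e = refl

  coneValue-misses : ∀ C L → any (C v) L ≡ false → coneValue C L ≡ coneBody C L
  coneValue-misses C L e rewrite e = refl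

  coneValue-cong : ∀ {C C′ : Relᵇ n} → (∀ x y → C x y ≡ C′ x y) → ∀ L → coneValue C L ≡ coneValue C′ L
  coneValue-cong {C} {C′} C≡ L =
    cong₂ (λ b x → if b then + 0 else x) (any-cong (C≡ v) L)
          (cong₂ _*_ (trans (cong (prodℤ ∘ map (weight C L)) (filterᵇ-cong awayFromV≡ (allFin n)))
                            (cong prodℤ (ListP.map-cong weight≡ (filterᵇ (awayFromV C′) (allFin n)))))
                     (cong (λ k → t ^ (k ∸ 1)) (classSize-row C C′ v (C≡ v))))
    where
      awayFromV≡ : awayFromV C ≗ awayFromV C′
      awayFromV≡ u = cong₂ (λ a b → a ∧ not b) (isClassRep-row C C′ u (C≡ u)) (C≡ v u)
      weight≡ : weight C L ≗ weight C′ L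
      weight≡ u = cong₂ classWeight (any-cong (C≡ u) L) (classSize-row C C′ u (C≡ u))

  module _ {C : Relᵇ n} (E : IsEquivalenceᵇ C) (i : Fin n) where
    private
      C′ = mergeClasses i v C

    merge-v : ∀ {y} → (C y i ∨ C y v) ≡ true → C′ v y ≡ true
    merge-v {y} e = ∨-trueʳ (C v y) (∧-true⁺ (∨-trueʳ (C v i) (reflᵇ E v)) e)

    coneValue-∷-joined : C i v ≡ true → ∀ L → coneValue C (i ∷ L) ≡ coneValue C L - coneValue C′ L
    coneValue-∷-joined civ L =
      trans (coneValue-meets C (i ∷ L) (∨-trueˡ _ (symᵇ E i v civ)))
            (sym (trans (cong (λ w → coneValue C L - w) (coneValue-cong merge≡ L)) (ℤP.+-inverseʳ (coneValue C L))))
      where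
        toV : ∀ {x} → (C x i ∨ C x v) ≡ true → C x v ≡ true
        toV {x} e = [ (λ cxi → transᵇ E x i v cxi civ) , (λ cxv → cxv) ]′ (∨-true⁻ (C x i) e)
        merge≡ : ∀ x y → C′ x y ≡ C x y
        merge≡ x y = true⇔true⇒≡ merged⇒C (∨-trueˡ _)
          where
            merged⇒C : C′ x y ≡ true → C x y ≡ true
            merged⇒C e with ∨-true⁻ (C x y) e
            ... | inj₁ cxy = cxy
            ... | inj₂ near with ∧-true⁻ (C x i ∨ C x v) near
            ...   | nx , ny = transᵇ E x v y (toV nx) (symᵇ E y v (toV ny))

    module Apart (civ : C i v ≡ false) where

      cvi : C v i ≡ false
      cvi = trans (symᵇ-≡ E v i) civ

      i-class-apart : ∀ {u} → C i u ≡ true → C v u ≡ false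
      i-class-apart {u} ciu = BoolP.¬-not λ cvu → BoolP.not-¬ (transᵇ E v u i cvu (symᵇ E i u ciu)) cvi

      row-outside : ∀ {u} → C i u ≡ false → C v u ≡ false → C′ u ≗ C u
      row-outside {u} ciu cvu y =
        trans (cong (λ b → C u y ∨ (b ∧ (C y i ∨ C y v)))
                    (cong₂ _∨_ (trans (symᵇ-≡ E u i) ciu) (trans (symᵇ-≡ E u v) cvu)))
              (BoolP.∨-identityʳ (C u y))

      row-v : C′ v ≗ λ y → C v y ∨ C i y
      row-v y = true⇔true⇒≡ to
        (λ e → [ ∨-trueˡ _ , (λ ciy → merge-v (∨-trueˡ _ (symᵇ E i y ciy))) ]′ (∨-true⁻ (C v y) e))
        where
          to : C′ v y ≡ true → (C v y ∨ C i y) ≡ true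
          to e with ∨-true⁻ (C v y) e
          ... | inj₁ cvy = ∨-trueˡ _ cvy
          ... | inj₂ near with ∨-true⁻ (C y i) (proj₂ (∧-true⁻ (C v i ∨ C v v) near))
          ...   | inj₁ cyi = ∨-trueʳ (C v y) (symᵇ E y i cyi)
          ...   | inj₂ cyv = ∨-trueˡ _ (symᵇ E y v cyv)

      classSize-merge-v : classSize C′ v ≡ classSize C v ℕ.+ classSize C i
      classSize-merge-v =
        trans (cong length (filterᵇ-cong row-v (allFin n)))
              (count-∨ (C v) (C i) (λ y cvy → BoolP.¬-not λ ciy → BoolP.not-¬ cvy (i-class-apart ciy)) (allFin n))

      awayFromV-merge : ∀ u → awayFromV C′ u ≡ awayFromV C u ∧ not (C i u)
      awayFromV-merge u with bool-cases (C i u) | bool-cases (C v u)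
      ... | inj₁ ciu | _ =
        trans (awayFromV-class-v C′ u (merge-v (∨-trueˡ _ (symᵇ E i u ciu))))
              (sym (trans (cong (λ b → awayFromV C u ∧ not b) ciu) (BoolP.∧-zeroʳ _)))
      ... | inj₂ ciu | inj₁ cvu =
        trans (awayFromV-class-v C′ u (∨-trueˡ _ cvu)) (sym (cong (_∧ not (C i u)) (awayFromV-class-v C u cvu)))
      ... | inj₂ ciu | inj₂ cvu =
        trans (cong₂ (λ a b → a ∧ not b) (isClassRep-row C′ C u (row-outside ciu cvu)) (trans (row-v u) (cong₂ _∨_ cvu ciu)))
              (trans (sym (BoolP.∧-identityʳ _)) (sym (cong₂ (λ a b → (isClassRep C u ∧ not a) ∧ not b) cvu ciu)))

      awayFromV-in-i : ∀ u → (awayFromV C u ∧ C i u) ≡ (isClassRep C u ∧ C i u)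
      awayFromV-in-i u with bool-cases (C i u)
      ... | inj₂ ciu rewrite ciu = trans (BoolP.∧-zeroʳ _) (sym (BoolP.∧-zeroʳ _))
      ... | inj₁ ciu rewrite ciu | i-class-apart ciu = cong (_∧ true) (BoolP.∧-identityʳ _)

      coneValue-∷-v-meets : ∀ L → any (C v) L ≡ true → coneValue C (i ∷ L) ≡ coneValue C L - coneValue C′ L
      coneValue-∷-v-meets L vL with any-true⁻ (C v) L vL
      ... | l , cvl , l∈L =
        trans (coneValue-meets C (i ∷ L) (∨-trueʳ (C v i) vL))
              (sym (cong₂ _-_ (coneValue-meets C L vL) (coneValue-meets C′ L (any-true⁺ (C′ v) l∈L (∨-trueˡ _ cvl)))))

      coneValue-∷-i-meets : ∀ L → any (C v) L ≡ false → any (C i) L ≡ true →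
                            coneValue C (i ∷ L) ≡ coneValue C L - coneValue C′ L
      coneValue-∷-i-meets L v∉L iL with any-true⁻ (C i) L iL
      ... | l , cil , l∈L = begin
        coneValue C (i ∷ L)             ≡⟨ coneValue-misses C (i ∷ L) (cong₂ _∨_ cvi v∉L) ⟩
        coneBody C (i ∷ L)              ≡⟨ cong (λ l → prodℤ l * t ^ (classSize C v ∸ 1))
                                                (ListP.map-cong weight≡ (filterᵇ (awayFromV C) (allFin n))) ⟩
        coneBody C L                    ≡⟨ coneValue-misses C L v∉L ⟨
        coneValue C L                   ≡⟨ ℤP.+-identityʳ _ ⟨
        coneValue C L - + 0             ≡⟨ cong (λ w → coneValue C L - w) (coneValue-meets C′ L v-meets) ⟨
        coneValue C L - coneValue C′ L  ∎
        where
          open ≡-Reasoning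
          v-meets : any (C′ v) L ≡ true
          v-meets = any-true⁺ (C′ v) l∈L (merge-v (∨-trueˡ _ (symᵇ E i l cil)))
          weight≡ : weight C (i ∷ L) ≗ weight C L
          weight≡ u = cong (λ b → classWeight b (classSize C u)) (true⇔true⇒≡
            (λ e → [ (λ cui → any-true⁺ (C u) l∈L (transᵇ E u i l cui cil)) , (λ r → r) ]′ (∨-true⁻ (C u i) e))
            (∨-trueʳ (C u i)))

      module Fresh (L : List (Fin n)) (v∉L : any (C v) L ≡ false) (i∉L : any (C i) L ≡ false) where

        rest : ℤ
        rest = prodℤ (map (weight C L) (filterᵇ (λ u → awayFromV C u ∧ not (C i u)) (allFin n)))

        tᵥ : ℤ
        tᵥ = t ^ (classSize C v ∸ 1)

        i-class-misses : ∀ {u} → C i u ≡ true → any (C u) L ≡ false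
        i-class-misses {u} ciu = BoolP.¬-not λ e →
          let (l , cul , l∈L) = any-true⁻ (C u) L e
          in BoolP.not-¬ (any-true⁺ (C i) l∈L (transᵇ E i u l ciu cul)) i∉L

        coneBody-L : coneBody C L ≡ (q (classSize C i) * + 1 * rest) * tᵥ
        coneBody-L = cong (_* tᵥ) (trans (prodℤ-filterᵇ-split (awayFromV C) (C i) (weight C L) (allFin n)) (cong (_* rest)
          (trans (prodℤ-filterᵇ-cong (λ u → awayFromV C u ∧ C i u)
                    (λ u e → cong (λ b → classWeight b (classSize C u)) (i-class-misses (proj₂ (∧-true⁻ (awayFromV C u) e))))
                    (allFin n))
                 (prodℤ-classRep E (λ u → awayFromV C u ∧ C i u) q i awayFromV-in-i))))

        coneBody-i∷L : coneBody C (i ∷ L) ≡ (q′ (classSize C i) * + 1 * rest) * tᵥ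
        coneBody-i∷L = cong (_* tᵥ) (trans (prodℤ-filterᵇ-split (awayFromV C) (C i) (weight C (i ∷ L)) (allFin n)) (cong₂ _*_
          (trans (prodℤ-filterᵇ-cong (λ u → awayFromV C u ∧ C i u)
                    (λ u e → cong (λ b → classWeight b (classSize C u))
                                  (∨-trueˡ _ (symᵇ E i u (proj₂ (∧-true⁻ (awayFromV C u) e)))))
                    (allFin n))
                 (prodℤ-classRep E (λ u → awayFromV C u ∧ C i u) q′ i awayFromV-in-i))
          (prodℤ-filterᵇ-cong (λ u → awayFromV C u ∧ not (C i u))
             (λ u e → cong (λ b → classWeight (b ∨ any (C u) L) (classSize C u))
                           (trans (symᵇ-≡ E u i) (not-true⁻ (proj₂ (∧-true⁻ (awayFromV C u) e)))))
             (allFin n))))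

        coneBody-merge : coneBody C′ L ≡ rest * (tᵥ * t ^ classSize C i)
        coneBody-merge = cong₂ _*_
          (trans (cong (prodℤ ∘ map (weight C′ L)) (filterᵇ-cong awayFromV-merge (allFin n)))
                 (prodℤ-filterᵇ-cong (λ u → awayFromV C u ∧ not (C i u)) weight-outside (allFin n)))
          (trans (cong (λ k → t ^ (k ∸ 1)) classSize-merge-v)
                 (trans (cong (t ^_) (ℕP.+-∸-comm (classSize C i) (classSize-pos E v)))
                        (ℤP.^-distribˡ-+-* t (classSize C v ∸ 1) (classSize C i))))
          where
            weight-outside : ∀ u → (awayFromV C u ∧ not (C i u)) ≡ true → weight C′ L u ≡ weight C L u
            weight-outside u e =
              let (away , ¬ciu) = ∧-true⁻ (awayFromV C u) e
                  outside = row-outside (not-true⁻ ¬ciu) (not-true⁻ (proj₂ (∧-true⁻ (isClassRep C u) away)))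
              in cong₂ classWeight (any-cong outside L) (classSize-row C′ C u outside)

        coneValue-∷-fresh : coneValue C (i ∷ L) ≡ coneValue C L - coneValue C′ L
        coneValue-∷-fresh = begin
          coneValue C (i ∷ L)                             ≡⟨ coneValue-misses C (i ∷ L) (cong₂ _∨_ cvi v∉L) ⟩
          coneBody C (i ∷ L)                              ≡⟨ coneBody-i∷L ⟩
          (q′ (classSize C i) * + 1 * rest) * tᵥ          ≡⟨ absorb (q (classSize C i)) (t ^ classSize C i) rest tᵥ ⟩
          (q (classSize C i) * + 1 * rest) * tᵥ - rest * (tᵥ * t ^ classSize C i)
                                                          ≡⟨ cong₂ _-_ coneBody-L coneBody-merge ⟨
          coneBody C L - coneBody C′ L                    ≡⟨ cong₂ _-_ (coneValue-misses C L v∉L) (coneValue-misses C′ L v∉L′) ⟨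
          coneValue C L - coneValue C′ L                  ∎
          where
            open ≡-Reasoning
            absorb : ∀ Q P R A → ((Q - P) * + 1 * R) * A ≡ (Q * + 1 * R) * A - R * (A * P)
            absorb = solve-∀
            v∉L′ : any (C′ v) L ≡ false
            v∉L′ = BoolP.¬-not λ e →
              let (l , c′vl , l∈L) = any-true⁻ (C′ v) L e
              in [ (λ cvl → BoolP.not-¬ (any-true⁺ (C v) l∈L cvl) v∉L)
                 , (λ cil → BoolP.not-¬ (any-true⁺ (C i) l∈L cil) i∉L) ]′
                   (∨-true⁻ (C v l) (trans (sym (row-v l)) c′vl))

    coneValue-∷ : ∀ L → coneValue C (i ∷ L) ≡ coneValue C L - coneValue C′ L
    coneValue-∷ L with bool-cases (C i v)
    ... | inj₁ civ = coneValue-∷-joined civ L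
    ... | inj₂ civ with bool-cases (any (C v) L) | bool-cases (any (C i) L)
    ...   | inj₁ vL  | _        = Apart.coneValue-∷-v-meets civ L vL
    ...   | inj₂ v∉L | inj₁ iL  = Apart.coneValue-∷-i-meets civ L v∉L iL
    ...   | inj₂ v∉L | inj₂ i∉L = Apart.Fresh.coneValue-∷-fresh civ L v∉L i∉L

  star : List (Fin n) → Graph n
  star A = map (λ a → (a , v)) A

  term : Graph n → ℤ
  term H = awayProduct q H v * t ^ (compSize H v ∸ 1)

  coneSum : Graph n → List (Fin n) → ℤ
  coneSum H = sumSubs (λ A → (- + 1) ^ length A * term (H ++ star A))

  coneSum≡coneValue : ∀ L H → coneSum H L ≡ coneValue (conn H) L
  coneSum≡coneValue [] H = trans (cong (λ K → + 1 * term K + + 0) (ListP.++-identityʳ H)) (law (term H))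
    where
      law : ∀ x → + 1 * x + + 0 ≡ x
      law = solve-∀
  coneSum≡coneValue (i ∷ L) H = begin
    coneSum H (i ∷ L)
      ≡⟨ sumSubs-∷ f i L ⟩
    coneSum H L + sumSubs (f ∘ (i ∷_)) L
      ≡⟨ cong (_+_ (coneSum H L)) (trans (cong sumℤ (ListP.map-cong edge-first (subs L))) (sumℤ-map-*ˡ (- + 1) _ (subs L))) ⟩
    coneSum H L + - + 1 * coneSum H⁺ L
      ≡⟨ cong (_+_ (coneSum H L)) (ℤP.-1*i≡-i (coneSum H⁺ L)) ⟩
    coneSum H L - coneSum H⁺ L
      ≡⟨ cong₂ _-_ (coneSum≡coneValue L H) (trans (coneSum≡coneValue L H⁺) (coneValue-cong (conn-++-edge H i v) L)) ⟩
    coneValue (conn H) L - coneValue (mergeClasses i v (conn H)) L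
      ≡⟨ coneValue-∷ (conn-isEquivalenceᵇ H) i L ⟨
    coneValue (conn H) (i ∷ L) ∎
    where
      open ≡-Reasoning
      f = λ A → (- + 1) ^ length A * term (H ++ star A)
      H⁺ = H ++ [ (i , v) ]
      edge-first : ∀ A → f (i ∷ A) ≡ - + 1 * ((- + 1) ^ length A * term (H⁺ ++ star A))
      edge-first A = trans (cong (λ K → (- + 1) ^ suc (length A) * term K) (sym (ListP.++-assoc H [ (i , v) ] (star A))))
                           (ℤP.*-assoc (- + 1) ((- + 1) ^ length A) _)

-- The complete graph as a cone

tabulate-∷ʳ : ∀ {A : Set} N (f : Fin (suc N) → A) → tabulate f ≡ tabulate (f ∘ inject₁) ++ [ f (fromℕ N) ]
tabulate-∷ʳ zero    f = refl
tabulate-∷ʳ (suc N) f = cong (f Fin.zero ∷_) (tabulate-∷ʳ N (f ∘ Fin.suc))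

allFin-suc : ∀ N → allFin (suc N) ≡ map inject₁ (allFin N) ++ [ fromℕ N ]
allFin-suc N = trans (tabulate-∷ʳ N (λ x → x)) (cong (_++ [ fromℕ N ]) (sym (ListP.map-tabulate (λ x → x) inject₁)))

module _ {N : ℕ} where

  inject₁² : Fin N × Fin N → Fin (suc N) × Fin (suc N)
  inject₁² (a , b) = (inject₁ a , inject₁ b)

  <ᵇ-inject₁ : ∀ (a b : Fin N) → (toℕ (inject₁ a) <ᵇ toℕ (inject₁ b)) ≡ (toℕ a <ᵇ toℕ b)
  <ᵇ-inject₁ a b = cong₂ _<ᵇ_ (FinP.toℕ-inject₁ a) (FinP.toℕ-inject₁ b)

  inject₁<ᵇfromℕ : ∀ (a : Fin N) → (toℕ (inject₁ a) <ᵇ toℕ (fromℕ N)) ≡ true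
  inject₁<ᵇfromℕ a = Equivalence.to BoolP.T-≡
    (ℕP.<⇒<ᵇ (subst₂ _<_ (sym (FinP.toℕ-inject₁ a)) (sym (FinP.toℕ-fromℕ N)) (FinP.toℕ<n a)))

  fromℕ≮ᵇ : ∀ (j : Fin (suc N)) → (toℕ (fromℕ N) <ᵇ toℕ j) ≡ false
  fromℕ≮ᵇ j = BoolP.¬-not λ lt → ℕP.<-irrefl refl
    (ℕP.<-≤-trans (subst (_< toℕ j) (FinP.toℕ-fromℕ N) (ℕP.<ᵇ⇒< _ _ (Equivalence.from BoolP.T-≡ lt)))
                  (ℕP.≤-pred (FinP.toℕ<n j)))

rowK : ∀ n → Fin n → Graph n
rowK n i = map (λ j → (i , j)) (filterᵇ (λ j → toℕ i <ᵇ toℕ j) (allFin n))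

rowK-inject₁ : ∀ N (a : Fin N) → rowK (suc N) (inject₁ a) ≡ map inject₁² (rowK N a) ++ [ (inject₁ a , fromℕ N) ]
rowK-inject₁ N a = begin
  map (inject₁ a ,_) (filterᵇ p (allFin (suc N)))
    ≡⟨ cong (map (inject₁ a ,_) ∘ filterᵇ p) (allFin-suc N) ⟩
  map (inject₁ a ,_) (filterᵇ p (map inject₁ (allFin N) ++ [ fromℕ N ]))
    ≡⟨ cong (map (inject₁ a ,_)) (filterᵇ-++ p (map inject₁ (allFin N)) [ fromℕ N ]) ⟩
  map (inject₁ a ,_) (filterᵇ p (map inject₁ (allFin N)) ++ filterᵇ p [ fromℕ N ])
    ≡⟨ cong₂ (λ l r → map (inject₁ a ,_) (l ++ r)) (filterᵇ-map p inject₁ (allFin N))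
                                                 (filterᵇ-accept p [] (inject₁<ᵇfromℕ a)) ⟩
  map (inject₁ a ,_) (map inject₁ (filterᵇ (p ∘ inject₁) (allFin N)) ++ [ fromℕ N ])
    ≡⟨ ListP.map-++ (inject₁ a ,_) (map inject₁ (filterᵇ (p ∘ inject₁) (allFin N))) [ fromℕ N ] ⟩
  map (inject₁ a ,_) (map inject₁ (filterᵇ (p ∘ inject₁) (allFin N))) ++ [ (inject₁ a , fromℕ N) ]
    ≡⟨ cong (_++ [ (inject₁ a , fromℕ N) ]) lifted-row ⟩
  map inject₁² (rowK N a) ++ [ (inject₁ a , fromℕ N) ] ∎
  where
    open ≡-Reasoning
    p = λ j → toℕ (inject₁ a) <ᵇ toℕ j
    lifted-row : map (inject₁ a ,_) (map inject₁ (filterᵇ (p ∘ inject₁) (allFin N))) ≡ map inject₁² (rowK N a)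
    lifted-row = trans (sym (ListP.map-∘ (filterᵇ (p ∘ inject₁) (allFin N))))
                       (trans (cong (map (λ j → (inject₁ a , inject₁ j))) (filterᵇ-cong (<ᵇ-inject₁ a) (allFin N)))
                              (ListP.map-∘ (filterᵇ (λ j → toℕ a <ᵇ toℕ j) (allFin N))))

rowK-fromℕ : ∀ N → rowK (suc N) (fromℕ N) ≡ []
rowK-fromℕ N = cong (map _) (filterᵇ-none _ (allFin (suc N)) fromℕ≮ᵇ)

concat-∷ʳ-↭ : ∀ {A B : Set} (f : A → List B) (g : A → B) L →
  concat (map (λ a → f a ++ [ g a ]) L) ↭ concat (map f L) ++ map g L
concat-∷ʳ-↭ f g []      = Perm.refl
concat-∷ʳ-↭ f g (a ∷ L) =
  ↭-trans (↭-reflexive (ListP.++-assoc (f a) [ g a ] _))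
    (↭-trans (PermP.++⁺ˡ (f a) (prep (g a) (concat-∷ʳ-↭ f g L)))
      (↭-trans (PermP.++⁺ˡ (f a) (↭-sym (PermP.shift (g a) (concat (map f L)) (map g L))))
        (↭-reflexive (sym (ListP.++-assoc (f a) (concat (map f L)) _)))))

K-suc-↭ : ∀ N → K (suc N) ↭ map inject₁² (K N) ++ map (λ a → (a , fromℕ N)) (map inject₁ (allFin N))
K-suc-↭ N = ↭-trans (↭-reflexive by-rows) (↭-trans (concat-∷ʳ-↭ old new (allFin N)) (↭-reflexive regroup))
  where
    old = λ a → map inject₁² (rowK N a)
    new = λ a → (inject₁ a , fromℕ N)
    by-rows : K (suc N) ≡ concat (map (λ a → old a ++ [ new a ]) (allFin N))
    by-rows = begin
      concat (map (rowK (suc N)) (allFin (suc N)))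
        ≡⟨ cong (concat ∘ map (rowK (suc N))) (allFin-suc N) ⟩
      concat (map (rowK (suc N)) (map inject₁ (allFin N) ++ [ fromℕ N ]))
        ≡⟨ cong concat (ListP.map-++ (rowK (suc N)) (map inject₁ (allFin N)) [ fromℕ N ]) ⟩
      concat (map (rowK (suc N)) (map inject₁ (allFin N)) ++ [ rowK (suc N) (fromℕ N) ])
        ≡⟨ ListP.concat-++ (map (rowK (suc N)) (map inject₁ (allFin N))) _ ⟨
      concat (map (rowK (suc N)) (map inject₁ (allFin N))) ++ (rowK (suc N) (fromℕ N) ++ [])
        ≡⟨ cong₂ _++_ (cong concat (trans (sym (ListP.map-∘ (allFin N))) (ListP.map-cong (rowK-inject₁ N) (allFin N))))
                      (cong (_++ []) (rowK-fromℕ N)) ⟩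
      concat (map (λ a → old a ++ [ new a ]) (allFin N)) ++ []
        ≡⟨ ListP.++-identityʳ _ ⟩
      concat (map (λ a → old a ++ [ new a ]) (allFin N)) ∎
      where open ≡-Reasoning
    regroup : concat (map old (allFin N)) ++ map new (allFin N) ≡
              map inject₁² (K N) ++ map (λ a → (a , fromℕ N)) (map inject₁ (allFin N))
    regroup = cong₂ _++_ (trans (cong concat (ListP.map-∘ (allFin N))) (ListP.concat-map (map (rowK N) (allFin N))))
                         (ListP.map-∘ (allFin N))

inject₁-or-fromℕ : ∀ {N} (z : Fin (suc N)) → (∃ λ z′ → z ≡ inject₁ z′) ⊎ z ≡ fromℕ N
inject₁-or-fromℕ {zero}  Fin.zero    = inj₂ refl
inject₁-or-fromℕ {suc N} Fin.zero    = inj₁ (Fin.zero , refl)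
inject₁-or-fromℕ {suc N} (Fin.suc z) with inject₁-or-fromℕ z
... | inj₁ (z′ , e) = inj₁ (Fin.suc z′ , cong Fin.suc e)
... | inj₂ e        = inj₂ (cong Fin.suc e)

module Lift {N : ℕ} (S : Graph N) where

  H : Graph (suc N)
  H = map inject₁² S

  eqF-inject₁ : ∀ (x y : Fin N) → eqF (inject₁ x) (inject₁ y) ≡ eqF x y
  eqF-inject₁ x y = true⇔true⇒≡
    (λ e → subst (λ z → eqF x z ≡ true) (FinP.inject₁-injective (eqF-true⁻ _ _ e)) (eqF-refl x))
    (λ e → subst (λ z → eqF (inject₁ x) (inject₁ z) ≡ true) (eqF-true⁻ _ _ e) (eqF-refl (inject₁ x)))

  adj-inject₁ : ∀ a b → adj H (inject₁ a) (inject₁ b) ≡ adj S a b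
  adj-inject₁ a b = trans (any-map _ inject₁² S) (any-cong (λ e → cong₂ _∨_
    (cong₂ _∧_ (eqF-inject₁ (proj₁ e) a) (eqF-inject₁ (proj₂ e) b))
    (cong₂ _∧_ (eqF-inject₁ (proj₁ e) b) (eqF-inject₁ (proj₂ e) a))) S)

  adj-fromℕ : ∀ b → adj H (fromℕ N) b ≡ false
  adj-fromℕ b = trans (any-map _ inject₁² S) (any-false⁺ _ S λ e → cong₂ _∨_
    (cong (_∧ eqF (inject₁ (proj₂ e)) b) (last≢ (proj₁ e)))
    (trans (cong (eqF (inject₁ (proj₁ e)) b ∧_) (last≢ (proj₂ e))) (BoolP.∧-zeroʳ _)))
    where
      last≢ : ∀ x → eqF (inject₁ x) (fromℕ N) ≡ false
      last≢ x = eqF-false⁺ (λ e → FinP.fromℕ≢inject₁ (sym e))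

  path-inject₁ : ∀ {x y} → Path S x y → Path H (inject₁ x) (inject₁ y)
  path-inject₁ = Star.gmap inject₁ (λ {a} {b} e → trans (adj-inject₁ a b) e)

  path-from-fromℕ : ∀ {z} → Path H (fromℕ N) z → z ≡ fromℕ N
  path-from-fromℕ ε                 = refl
  path-from-fromℕ (_◅_ {j = m} e p) = ⊥-elim (BoolP.not-¬ e (adj-fromℕ m))

  path-from-inject₁ : ∀ {x z} → Path H (inject₁ x) z → ∃ λ z′ → z ≡ inject₁ z′ × Path S x z′
  path-from-inject₁ ε = _ , refl , ε
  path-from-inject₁ {x} (_◅_ {j = m} e p) with inject₁-or-fromℕ m
  ... | inj₁ (m′ , refl) =
    let (z′ , z≡ , p′) = path-from-inject₁ p in z′ , z≡ , (trans (sym (adj-inject₁ x m′)) e ◅ p′)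
  ... | inj₂ refl = ⊥-elim (BoolP.not-¬ e (trans (adj-sym H (inject₁ x) (fromℕ N)) (adj-fromℕ (inject₁ x))))

  conn-inject₁ : ∀ x y → conn H (inject₁ x) (inject₁ y) ≡ conn S x y
  conn-inject₁ x y = true⇔true⇒≡ project (λ e → path⇒conn H (path-inject₁ (conn⇒path S x y e)))
    where
      project : conn H (inject₁ x) (inject₁ y) ≡ true → conn S x y ≡ true
      project e with path-from-inject₁ (conn⇒path H _ _ e)
      ... | z′ , z≡ , p with FinP.inject₁-injective z≡
      ...   | refl = path⇒conn S p

  conn-fromℕ-inject₁ : ∀ y → conn H (fromℕ N) (inject₁ y) ≡ false
  conn-fromℕ-inject₁ y = BoolP.¬-not λ e → FinP.fromℕ≢inject₁ (sym (path-from-fromℕ (conn⇒path H _ _ e)))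

  conn-inject₁-fromℕ : ∀ y → conn H (inject₁ y) (fromℕ N) ≡ false
  conn-inject₁-fromℕ y = trans (symᵇ-≡ (conn-isEquivalenceᵇ H) (inject₁ y) (fromℕ N)) (conn-fromℕ-inject₁ y)

  filterᵇ-allFin-suc : ∀ (p : Fin (suc N) → Bool) →
    filterᵇ p (allFin (suc N)) ≡ map inject₁ (filterᵇ (p ∘ inject₁) (allFin N)) ++ filterᵇ p [ fromℕ N ]
  filterᵇ-allFin-suc p = trans (cong (filterᵇ p) (allFin-suc N))
    (trans (filterᵇ-++ p (map inject₁ (allFin N)) [ fromℕ N ])
           (cong (_++ filterᵇ p [ fromℕ N ]) (filterᵇ-map p inject₁ (allFin N))))

  compSize-inject₁ : ∀ x → compSize H (inject₁ x) ≡ compSize S x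
  compSize-inject₁ x = begin
    length (filterᵇ (conn H (inject₁ x)) (allFin (suc N)))
      ≡⟨ cong length (filterᵇ-allFin-suc (conn H (inject₁ x))) ⟩
    length (map inject₁ (filterᵇ (conn H (inject₁ x) ∘ inject₁) (allFin N)) ++ filterᵇ (conn H (inject₁ x)) [ fromℕ N ])
      ≡⟨ cong₂ (λ l r → length (map inject₁ l ++ r)) (filterᵇ-cong (conn-inject₁ x) (allFin N))
                                                       (filterᵇ-reject (conn H (inject₁ x)) [] (conn-inject₁-fromℕ x)) ⟩
    length (map inject₁ (filterᵇ (conn S x) (allFin N)) ++ [])
      ≡⟨ cong length (ListP.++-identityʳ (map inject₁ (filterᵇ (conn S x) (allFin N)))) ⟩
    length (map inject₁ (filterᵇ (conn S x) (allFin N)))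
      ≡⟨ ListP.length-map inject₁ (filterᵇ (conn S x) (allFin N)) ⟩
    compSize S x ∎
    where open ≡-Reasoning

  compSize-fromℕ : compSize H (fromℕ N) ≡ 1
  compSize-fromℕ = cong length (trans (filterᵇ-allFin-suc (conn H (fromℕ N)))
    (cong₂ (λ l r → map inject₁ l ++ r) (filterᵇ-none _ (allFin N) conn-fromℕ-inject₁)
                                        (filterᵇ-accept (conn H (fromℕ N)) [] (reflᵇ (conn-isEquivalenceᵇ H) (fromℕ N)))))

  isRep-inject₁ : ∀ x → isRep H (inject₁ x) ≡ isRep S x
  isRep-inject₁ x = cong not (begin
    any p (allFin (suc N))                                   ≡⟨ cong (any p) (allFin-suc N) ⟩
    any p (map inject₁ (allFin N) ++ [ fromℕ N ])             ≡⟨ any-++ p (map inject₁ (allFin N)) [ fromℕ N ] ⟩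
    any p (map inject₁ (allFin N)) ∨ any p [ fromℕ N ]        ≡⟨ cong₂ _∨_ (any-map p inject₁ (allFin N)) last-term ⟩
    any (p ∘ inject₁) (allFin N) ∨ false                     ≡⟨ BoolP.∨-identityʳ _ ⟩
    any (p ∘ inject₁) (allFin N)                             ≡⟨ any-cong (λ j → cong₂ _∧_ (<ᵇ-inject₁ j x) (conn-inject₁ x j)) (allFin N) ⟩
    any (λ j → (toℕ j <ᵇ toℕ x) ∧ conn S x j) (allFin N)     ∎)
    where
      open ≡-Reasoning
      p = λ j → (toℕ j <ᵇ toℕ (inject₁ x)) ∧ conn H (inject₁ x) j
      last-term : any p [ fromℕ N ] ≡ false
      last-term = cong (_∨ false)
        (trans (cong ((toℕ (fromℕ N) <ᵇ toℕ (inject₁ x)) ∧_) (conn-inject₁-fromℕ x)) (BoolP.∧-zeroʳ _))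

  module _ (q : ℕ → ℤ) (t : ℤ) where
    open Cone q t (fromℕ N)
    private
      C = conn H
      E = conn-isEquivalenceᵇ H
      old = map inject₁ (allFin N)

    awayFromV-lift : filterᵇ (awayFromV C) (allFin (suc N)) ≡ map inject₁ (filterᵇ (isRep S) (allFin N))
    awayFromV-lift =
      trans (filterᵇ-allFin-suc (awayFromV C))
            (trans (cong₂ (λ l r → map inject₁ l ++ r) (filterᵇ-cong away-inject₁ (allFin N)) last-rejected)
                   (ListP.++-identityʳ _))
      where
        away-inject₁ : awayFromV C ∘ inject₁ ≗ isRep S
        away-inject₁ u = trans (cong₂ (λ a b → a ∧ not b) (isRep-inject₁ u) (conn-fromℕ-inject₁ u)) (BoolP.∧-identityʳ _)
        last-rejected : filterᵇ (awayFromV C) [ fromℕ N ] ≡ []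
        last-rejected = filterᵇ-reject (awayFromV C) []
          (trans (cong (λ b → isClassRep C (fromℕ N) ∧ not b) (reflᵇ E (fromℕ N))) (BoolP.∧-zeroʳ _))

    weight-lift : ∀ u → weight C old (inject₁ u) ≡ q′ (compSize S u)
    weight-lift u = cong₂ classWeight (any-true⁺ (C (inject₁ u)) (∈-map⁺ inject₁ (∈-allFin u)) (reflᵇ E (inject₁ u)))
                                      (compSize-inject₁ u)

    coneValue-lift : coneValue C old ≡ prodℤ (map (q′ ∘ compSize S) (filterᵇ (isRep S) (allFin N)))
    coneValue-lift = begin
      coneValue C old
        ≡⟨ coneValue-misses C old
             (trans (any-map (C (fromℕ N)) inject₁ (allFin N)) (any-false⁺ _ (allFin N) conn-fromℕ-inject₁)) ⟩
      prodℤ (map (weight C old) (filterᵇ (awayFromV C) (allFin (suc N)))) * t ^ (classSize C (fromℕ N) ∸ 1)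
        ≡⟨ cong₂ (λ l k → prodℤ (map (weight C old) l) * t ^ (k ∸ 1)) awayFromV-lift compSize-fromℕ ⟩
      prodℤ (map (weight C old) (map inject₁ reps)) * + 1
        ≡⟨ ℤP.*-identityʳ _ ⟩
      prodℤ (map (weight C old) (map inject₁ reps))
        ≡⟨ cong prodℤ (trans (sym (ListP.map-∘ reps)) (ListP.map-cong weight-lift reps)) ⟩
      prodℤ (map (q′ ∘ compSize S) reps) ∎
      where
        open ≡-Reasoning
        reps = filterᵇ (isRep S) (allFin N)

-- Induction over complete graphs

module _ {n : ℕ} where

  conn-↭ : ∀ {S S′ : Graph n} → S ↭ S′ → ∀ a b → conn S a b ≡ conn S′ a b
  conn-↭ p = conn-cong (λ a b → any-↭ _ p)

  awayProduct-cong : ∀ q {S S′ : Graph n} v → (∀ a b → conn S a b ≡ conn S′ a b) →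
                     awayProduct q S v ≡ awayProduct q S′ v
  awayProduct-cong q {S} {S′} v C≡ =
    trans (cong prodℤ (ListP.map-cong (λ u → cong q (classSize-row (conn S) (conn S′) u (C≡ u)))
                                         (filterᵇ (λ u → isRep S u ∧ not (conn S v u)) (allFin n))))
          (cong (prodℤ ∘ map (q ∘ compSize S′))
                (filterᵇ-cong (λ u → cong₂ (λ a b → a ∧ not b) (isClassRep-row (conn S) (conn S′) u (C≡ u)) (C≡ v u))
                              (allFin n)))

  pointedTerm-↭ : ∀ v q w → RespectsPerm (λ S → (- + 1) ^ length S * awayProduct q S v * w (compSize S v))
  pointedTerm-↭ v q w {S} {S′} p =
    cong₂ _*_ (cong₂ _*_ (cong ((- + 1) ^_) (PermP.↭-length p)) (awayProduct-cong q v (conn-↭ p)))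
              (cong w (classSize-row (conn S) (conn S′) v (conn-↭ p v)))

  componentProduct≡awayProduct : ∀ q (S : Graph n) v → componentProduct q S ≡ awayProduct q S v * q (compSize S v)
  componentProduct≡awayProduct q S v = begin
    componentProduct q S
      ≡⟨ prodℤ-filterᵇ-split (isRep S) (conn S v) (q ∘ compSize S) (allFin n) ⟩
    prodℤ (map (q ∘ compSize S) (filterᵇ (λ u → isRep S u ∧ conn S v u) (allFin n))) * awayProduct q S v
      ≡⟨ cong (_* awayProduct q S v) (prodℤ-classRep (conn-isEquivalenceᵇ S) (λ u → isRep S u ∧ conn S v u) q v (λ u → refl)) ⟩
    q (compSize S v) * + 1 * awayProduct q S v
      ≡⟨ cong (_* awayProduct q S v) (ℤP.*-identityʳ (q (compSize S v))) ⟩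
    q (compSize S v) * awayProduct q S v
      ≡⟨ ℤP.*-comm (q (compSize S v)) (awayProduct q S v) ⟩
    awayProduct q S v * q (compSize S v) ∎
    where open ≡-Reasoning

  chromaticX≡pointedX : ∀ (G : Graph n) v q → chromaticX G q ≡ pointedX G v q q
  chromaticX≡pointedX G v q = cong sumℤ (ListP.map-cong (λ S →
    trans (cong ((- + 1) ^ length S *_) (componentProduct≡awayProduct q S v))
          (sym (ℤP.*-assoc ((- + 1) ^ length S) (awayProduct q S v) (q (compSize S v))))) (subs G))

  chromaticX-cong : ∀ (G : Graph n) {q q′} → q ≗ q′ → chromaticX G q ≡ chromaticX G q′
  chromaticX-cong G e = cong sumℤ (ListP.map-cong (λ S →
    cong ((- + 1) ^ length S *_) (cong prodℤ (ListP.map-cong (λ u → e (compSize S u)) (filterᵇ (isRep S) (allFin n))))) (subs G))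

pointedX-K-suc : ∀ N q t → pointedX (K (suc N)) (fromℕ N) q (λ k → t ^ (k ∸ 1)) ≡ chromaticX (K N) (λ k → q k - t ^ k)
pointedX-K-suc N q t = begin
  sumSubs f (K (suc N))
    ≡⟨ sumSubs-↭ (K-suc-↭ N) f (pointedTerm-↭ (fromℕ N) q w) ⟩
  sumSubs f (map inject₁² (K N) ++ star old)
    ≡⟨ sumSubs-++ f (map inject₁² (K N)) (star old) ⟩
  sumSubs (λ S → sumSubs (λ B → f (S ++ B)) (star old)) (map inject₁² (K N))
    ≡⟨ sumSubs-map _ inject₁² (K N) ⟩
  sumSubs (λ S → sumSubs (λ B → f (Lift.H S ++ B)) (star old)) (K N)
    ≡⟨ cong sumℤ (ListP.map-cong cone-over (subs (K N))) ⟩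
  chromaticX (K N) (λ k → q k - t ^ k) ∎
  where
    open ≡-Reasoning
    open Cone q t (fromℕ N)
    w = λ k → t ^ (k ∸ 1)
    f = λ S → (- + 1) ^ length S * awayProduct q S (fromℕ N) * w (compSize S (fromℕ N))
    old = map inject₁ (allFin N)
    split-sign : ∀ H A → f (H ++ star A) ≡ (- + 1) ^ length H * ((- + 1) ^ length A * term (H ++ star A))
    split-sign H A = begin
      (- + 1) ^ length (H ++ star A) * a * b
        ≡⟨ cong (λ k → (- + 1) ^ k * a * b) (trans (ListP.length-++ H) (cong (length H ℕ.+_) (ListP.length-map _ A))) ⟩
      (- + 1) ^ (length H ℕ.+ length A) * a * b
        ≡⟨ cong (λ s → s * a * b) (ℤP.^-distribˡ-+-* (- + 1) (length H) (length A)) ⟩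
      (- + 1) ^ length H * (- + 1) ^ length A * a * b
        ≡⟨ reassoc ((- + 1) ^ length H) ((- + 1) ^ length A) a b ⟩
      (- + 1) ^ length H * ((- + 1) ^ length A * (a * b)) ∎
      where
        a = awayProduct q (H ++ star A) (fromℕ N)
        b = w (compSize (H ++ star A) (fromℕ N))
        reassoc : ∀ a b c d → a * b * c * d ≡ a * (b * (c * d))
        reassoc = solve-∀
    cone-over : ∀ S → sumSubs (λ B → f (Lift.H S ++ B)) (star old) ≡ (- + 1) ^ length S * componentProduct q′ S
    cone-over S = begin
      sumSubs (λ B → f (Lift.H S ++ B)) (star old)
        ≡⟨ sumSubs-map _ (λ a → (a , fromℕ N)) old ⟩
      sumSubs (λ A → f (Lift.H S ++ star A)) old
        ≡⟨ cong sumℤ (ListP.map-cong (split-sign (Lift.H S)) (subs old)) ⟩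
      sumℤ (map (λ A → (- + 1) ^ length (Lift.H S) * ((- + 1) ^ length A * term (Lift.H S ++ star A))) (subs old))
        ≡⟨ sumℤ-map-*ˡ ((- + 1) ^ length (Lift.H S)) _ (subs old) ⟩
      (- + 1) ^ length (Lift.H S) * coneSum (Lift.H S) old
        ≡⟨ cong₂ (λ k c → (- + 1) ^ k * c) (ListP.length-map inject₁² S)
                 (trans (coneSum≡coneValue old (Lift.H S)) (Lift.coneValue-lift S q t)) ⟩
      (- + 1) ^ length S * componentProduct q′ S ∎

powerSumDiff : List ℤ → List ℤ → ℕ → ℤ
powerSumDiff P M k = powerSum P k - powerSum M k

powerSumDiff-suc : ∀ P M k →
  powerSumDiff P M (suc k) ≡ sumℤ (map (λ y → y * y ^ k) P) + sumℤ (map (λ z → (- z) * z ^ k) M)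
powerSumDiff-suc P M k = cong (_+_ (powerSum P (suc k)))
  (trans (neg-sumℤ-map (λ z → z ^ suc k) M) (cong sumℤ (ListP.map-cong (λ z → ℤP.neg-distribˡ-* z (z ^ k)) M)))

module _ {n : ℕ} (G : Graph n) (v : Fin n) (q : ℕ → ℤ) where
  private
    sign×away : Graph n → ℤ
    sign×away S = (- + 1) ^ length S * awayProduct q S v

  pointedX-linear : ∀ {A : Set} (c : A → ℤ) (h : A → ℕ → ℤ) L →
    sumSubs (λ S → sign×away S * sumℤ (map (λ y → c y * h y (compSize S v)) L)) G ≡
    sumℤ (map (λ y → c y * pointedX G v q (h y)) L)
  pointedX-linear c h L = begin
    sumℤ (map (λ S → sign×away S * sumℤ (map (λ y → c y * h y (compSize S v)) L)) (subs G))
      ≡⟨ cong sumℤ (ListP.map-cong (λ S → trans (sym (sumℤ-map-*ˡ (sign×away S) _ L))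
                                                (cong sumℤ (ListP.map-cong (λ y → x∙yz≈y∙xz (sign×away S) (c y) _) L)))
                                   (subs G)) ⟩
    sumℤ (map (λ S → sumℤ (map (λ y → c y * (sign×away S * h y (compSize S v))) L)) (subs G))
      ≡⟨ sumℤ-map-comm (λ S y → c y * (sign×away S * h y (compSize S v))) (subs G) L ⟩
    sumℤ (map (λ y → sumℤ (map (λ S → c y * (sign×away S * h y (compSize S v))) (subs G))) L)
      ≡⟨ cong sumℤ (ListP.map-cong (λ y → sumℤ-map-*ˡ (c y) (λ S → sign×away S * h y (compSize S v)) (subs G)) L) ⟩
    sumℤ (map (λ y → c y * pointedX G v q (h y)) L) ∎
    where open ≡-Reasoning

  pointedX-powerSumDiff : ∀ P M → pointedX G v q (powerSumDiff P M) ≡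
    sumℤ (map (λ y → y * pointedX G v q (λ k → y ^ (k ∸ 1))) P) +
    sumℤ (map (λ z → (- z) * pointedX G v q (λ k → z ^ (k ∸ 1))) M)
  pointedX-powerSumDiff P M =
    trans (cong sumℤ (ListP.map-cong (λ S → trans (cong (sign×away S *_) (expand S)) (ℤP.*-distribˡ-+ (sign×away S) _ _))
                                     (subs G)))
          (trans (sumℤ-map-+ _ _ (subs G))
                 (cong₂ _+_ (pointedX-linear (λ y → y) (λ y k → y ^ (k ∸ 1)) P)
                            (pointedX-linear -_ (λ z k → z ^ (k ∸ 1)) M)))
    where
      expand : ∀ S → powerSumDiff P M (compSize S v) ≡
        sumℤ (map (λ y → y * y ^ (compSize S v ∸ 1)) P) + sumℤ (map (λ z → (- z) * z ^ (compSize S v ∸ 1)) M)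
      expand S = trans (cong (powerSumDiff P M) (sym suc-pred)) (powerSumDiff-suc P M (compSize S v ∸ 1))
        where
          suc-pred : suc (compSize S v ∸ 1) ≡ compSize S v
          suc-pred = trans (ℕP.+-comm 1 _) (ℕP.m∸n+n≡m (classSize-pos (conn-isEquivalenceᵇ S) v))

chromaticX-K : ∀ N P M → chromaticX (K N) (powerSumDiff P M) ≡ + (N !) * elemGF P M N
chromaticX-K zero    P M = sym (trans (ℤP.*-identityˡ _) (elemGF-0 P M))
chromaticX-K (suc N) P M = begin
  chromaticX (K (suc N)) q
    ≡⟨ chromaticX≡pointedX (K (suc N)) (fromℕ N) q ⟩
  pointedX (K (suc N)) (fromℕ N) q q
    ≡⟨ pointedX-powerSumDiff (K (suc N)) (fromℕ N) q P M ⟩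
  sumℤ (map (λ y → y * pointedX (K (suc N)) (fromℕ N) q (λ k → y ^ (k ∸ 1))) P) +
  sumℤ (map (λ z → (- z) * pointedX (K (suc N)) (fromℕ N) q (λ k → z ^ (k ∸ 1))) M)
    ≡⟨ cong₂ _+_ (cong sumℤ (ListP.map-cong (λ y → cong (y *_) (cone y)) P))
                 (cong sumℤ (ListP.map-cong (λ z → cong ((- z) *_) (cone z)) M)) ⟩
  sumℤ (map (λ y → y * (+ (N !) * elemGF P (y ∷ M) N)) P) + sumℤ (map (λ z → (- z) * (+ (N !) * elemGF P (z ∷ M) N)) M)
    ≡⟨ cong₂ _+_ (factor (λ y → y) P) (factor -_ M) ⟩
  + (N !) * sumℤ (map (λ y → y * elemGF P (y ∷ M) N) P) + + (N !) * sumℤ (map (λ z → (- z) * elemGF P (z ∷ M) N) M)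
    ≡⟨ ℤP.*-distribˡ-+ (+ (N !)) _ _ ⟨
  + (N !) * (sumℤ (map (λ y → y * elemGF P (y ∷ M) N) P) + sumℤ (map (λ z → (- z) * elemGF P (z ∷ M) N) M))
    ≡⟨ cong (+ (N !) *_) (newton P M N) ⟨
  + (N !) * (+ suc N * elemGF P M (suc N))
    ≡⟨ x∙yz≈y∙xz (+ (N !)) (+ suc N) (elemGF P M (suc N)) ⟩
  + suc N * (+ (N !) * elemGF P M (suc N))
    ≡⟨ ℤP.*-assoc (+ suc N) (+ (N !)) _ ⟨
  + suc N * + (N !) * elemGF P M (suc N)
    ≡⟨ cong (_* elemGF P M (suc N)) (ℤP.pos-* (suc N) (N !)) ⟨
  + (suc N !) * elemGF P M (suc N) ∎
  where
    open ≡-Reasoning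
    q = powerSumDiff P M
    cone : ∀ y → pointedX (K (suc N)) (fromℕ N) q (λ k → y ^ (k ∸ 1)) ≡ + (N !) * elemGF P (y ∷ M) N
    cone y = trans (pointedX-K-suc N q y)
                   (trans (chromaticX-cong (K N) (λ k → law (powerSum P k) (powerSum M k) (y ^ k))) (chromaticX-K N P (y ∷ M)))
      where
        law : ∀ p m y → p - m - y ≡ p - (y + m)
        law = solve-∀
    factor : ∀ (c : ℤ → ℤ) L → sumℤ (map (λ y → c y * (+ (N !) * elemGF P (y ∷ M) N)) L) ≡
                               + (N !) * sumℤ (map (λ y → c y * elemGF P (y ∷ M) N) L)
    factor c L = trans (cong sumℤ (ListP.map-cong (λ y → x∙yz≈y∙xz (c y) (+ (N !)) _) L)) (sumℤ-map-*ˡ (+ (N !)) _ L)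

theorem4p6 : (m : ℕ) (xs : List ℤ) (t : ℤ) →
    X (K (suc m)) (fromℕ m) xs t ≡ + (m !) * enn (suc m) xs t
theorem4p6 m xs t = begin
  X (K (suc m)) (fromℕ m) xs t                          ≡⟨⟩
  pointedX (K (suc m)) (fromℕ m) (powerSum xs) (λ k → t ^ (k ∸ 1))
                                                        ≡⟨ pointedX-K-suc m (powerSum xs) t ⟩
  chromaticX (K m) (λ k → powerSum xs k - t ^ k)        ≡⟨ chromaticX-cong (K m) (λ k → cong (_-_ (powerSum xs k)) (sym (ℤP.+-identityʳ (t ^ k)))) ⟩
  chromaticX (K m) (powerSumDiff xs [ t ])              ≡⟨ chromaticX-K m xs [ t ] ⟩
  + (m !) * elemGF xs [ t ] m                           ≡⟨ cong (+ (m !) *_) (enn≡elemGF m xs t) ⟨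
  + (m !) * enn (suc m) xs t                            ∎
  where open ≡-Reasoning
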